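{- Let $t\geq 3$ and let $\alpha=[\alpha_1,\dots,\alpha_t]$ and $\tilde\alpha=[\tilde\alpha_1,\dots,\tilde\alpha_t]$ be compositions (of $n$ and $\tilde n$ respectively) such that, for some $1\leq k\leq t-1$, the set of resonances of $\tilde\alpha$ equals the union of the set of resonances of $\alpha$ with the single new resonance $\tilde\alpha_1+\dots+\tilde\alpha_k=\tilde\alpha_{k+1}+\dots+\tilde\alpha_t$. Let $\lambda=(\alpha_1,\dots,\alpha_t)$ and $\tilde\lambda=(\tilde\alpha_1,\dots,\tilde\alpha_t)$. Then $\widetilde H_*(\delta_{\tilde\lambda})\cong\widetilde H_*(\delta_\lambda)\oplus\mathbb{Z}_{(1)}$, and correspondingly $\widetilde H_*(\widehat{\mathrm{Hyp}^{\tilde n}_{\tilde\lambda}})\cong\widetilde H_*(\widehat{\mathrm{Hyp}^n_\lambda})\oplus\mathbb{Z}_{(3)}$.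
   Context: A resonance of a composition $[\pi_1,\dots,\pi_l]$ is an unordered pair $(I,J)$ of nonempty disjoint subsets of $\{1,\dots,l\}$ with $\sum_{i\in I}\pi_i=\sum_{j\in J}\pi_j$; resonances of two compositions of the same length are compared as such pairs of index sets. A composition of $n$ is an ordered tuple of positive integers with sum $n$; a number partition is such a tuple unordered; the type of a composition is its underlying number partition. Compositions are ordered by $[a_1,\dots,a_p]\leq[b_1,\dots,b_q]$ iff there are $0=i_0<\dots<i_p=q$ with $a_j=b_{i_{j-1}+1}+\dots+b_{i_j}$ for all $j$. For a number partition $\lambda$ of $n$, $D_\lambda$ is the poset of compositions of $n$ that are $\leq$ some composition of type $\lambda$, and $\delta_\lambda$ is the simplicial complex whose face poset (empty face included) is $D_\lambda$ (composition of length $l$ $\leftrightarrow$ $(l-2)$-simplex). $\widehat{\mathrm{Hyp}^n_\lambda}$ is the one-point compactification of the closure, in the space of monic degree-$n$ real polynomials with only real roots, of the set of polynomials $\prod_{i=1}^s(x-r_i)^{a_i}$ with $r_1<\dots<r_s$ and $[a_1,\dots,a_s]$ of type $\lambda$; it is homeomorphic to the double suspension of $\delta_\lambda$. All homology is reduced with integer coefficients; $\mathbb{Z}_{(i)}$ denotes a direct summand $\mathbb{Z}$ in the $i$-th reduced homology group. -}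

module Defs where

open import Data.Bool using (Bool; true; false; if_then_else_)
open import Data.Nat as ℕ using (ℕ; zero; suc; _∸_; _<ᵇ_; _≡ᵇ_)
open import Data.Integer as ℤ using (ℤ; 0ℤ; 1ℤ; -_)
open import Data.Fin using (Fin; toℕ)
open import Data.Fin.Subset using (Subset; Nonempty; Empty; _∩_; ∁)
open import Data.Vec as Vec using (Vec; []; _∷_; tabulate)
open import Data.List as List using (List; []; _∷_; _++_; length; upTo)
open import Data.List.Relation.Binary.Permutation.Propositional using (_↭_)
open import Data.Product using (Σ; ∃; _×_; _,_; proj₁)
open import Data.Unit using (⊤; tt)
open import Relation.Nullary using (¬_)
open import Relation.Binary.PropositionalEquality using (_≡_; _≢_)

sumℕ : List ℕ → ℕ
sumℕ = List.foldr ℕ._+_ 0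

sumℤ : List ℤ → ℤ
sumℤ = List.foldr ℤ._+_ 0ℤ

AllPos : ∀ {t} → Vec ℕ t → Set
AllPos []       = ⊤
AllPos (a ∷ as) = (1 ℕ.≤ a) × AllPos as

sumSub : ∀ {t} → Vec ℕ t → Subset t → ℕ
sumSub []       []            = 0
sumSub (a ∷ as) (true  ∷ I)   = a ℕ.+ sumSub as I
sumSub (a ∷ as) (false ∷ I)   = sumSub as I

Disjoint : ∀ {t} → Subset t → Subset t → Set
Disjoint I J = Empty (I ∩ J)

-- (I , J) is a resonance of the composition a (as an ordered pair;
-- the relation is symmetric, so it describes unordered pairs)
IsResonance : ∀ {t} → Vec ℕ t → Subset t → Subset t → Set
IsResonance a I J = Nonempty I × Nonempty J × Disjoint I J × (sumSub a I ≡ sumSub a J)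

SamePair : ∀ {t} → Subset t → Subset t → Subset t → Subset t → Set
SamePair I J P Q = ((I ≡ P) × (J ≡ Q)) Data.Sum.⊎ ((I ≡ Q) × (J ≡ P))
  where import Data.Sum

-- {1,…,k} and {k+1,…,t} (0-based: indices < k and indices ≥ k)
front : (t k : ℕ) → Subset t
front t k = tabulate (λ i → toℕ i <ᵇ k)

back : (t k : ℕ) → Subset t
back t k = ∁ (front t k)

-- Order on compositions: [a₁…a_p] ≤ [b₁…b_q] iff a is obtained from b by
-- summing consecutive nonempty blocks.

data _≤c_ : List ℕ → List ℕ → Set where
  nil  : [] ≤c []
  cons : ∀ {a as} (bs₁ bs : List ℕ) → bs₁ ≢ [] → a ≡ sumℕ bs₁ →
         as ≤c bs → (a ∷ as) ≤c (bs₁ ++ bs)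

-- w ∈ D_λ : w is ≤ some composition of type λ (a rearrangement of λ)
InD : List ℕ → List ℕ → Set
InD λ' w = ∃ λ β → (β ↭ λ') × (w ≤c β)

-- Augmented simplicial chain complex of δ_λ, indexed via its face poset:
-- a composition of length l is an (l-2)-simplex, so chains "of length l"
-- live in reduced homological degree l-2.

Chain : List ℕ → ℕ → Set
Chain λ' l = Σ (List ℕ → ℤ) λ c → ∀ w → ¬ (InD λ' w × (length w ≡ l)) → c w ≡ 0ℤ

splits : ℕ → List (ℕ × ℕ)
splits m = List.map (λ a → (suc a , m ∸ suc a)) (upTo (m ∸ 1))

-- signed one-step refinements of w: splitting the j-th part (0-based)
-- carries sign (-1)^j (= removing the j-th vertex of the simplex of the
-- refinement, vertices being the partial sums in increasing order)
refine : List ℕ → List (ℤ × List ℕ)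
refine []      = []
refine (m ∷ w) =
  List.map (λ p → (1ℤ , proj₁ p ∷ Data.Product.proj₂ p ∷ w)) (splits m)
  ++ List.map (λ p → (- proj₁ p , m ∷ Data.Product.proj₂ p)) (refine w)

-- boundary (as a function on all words; maps length (l+1) chains to length l)
∂ : (List ℕ → ℤ) → (List ℕ → ℤ)
∂ c w = sumℤ (List.map (λ p → proj₁ p ℤ.* c (Data.Product.proj₂ p)) (refine w))

-- Groups given by carrier, equivalence and operation (laws not recorded;
-- isomorphisms are bijective homomorphisms up to the equivalence)

record GrpLike : Set₁ where
  field
    Carrier : Set
    _≈_     : Carrier → Carrier → Set
    _∙_     : Carrier → Carrier → Carrier

record _≅_ (G H : GrpLike) : Set where
  private
    module G = GrpLike G
    module H = GrpLike H
  field
    to        : G.Carrier → H.Carrier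
    from      : H.Carrier → G.Carrier
    to-cong   : ∀ {x y} → x G.≈ y → to x H.≈ to y
    from-cong : ∀ {x y} → x H.≈ y → from x G.≈ from y
    to-hom    : ∀ x y → to (x G.∙ y) H.≈ (to x H.∙ to y)
    to-from   : ∀ y → to (from y) H.≈ y
    from-to   : ∀ x → from (to x) G.≈ x

_⊕_ : GrpLike → GrpLike → GrpLike
G ⊕ H = record
  { Carrier = G.Carrier × H.Carrier
  ; _≈_     = λ x y → (proj₁ x G.≈ proj₁ y) × (Data.Product.proj₂ x H.≈ Data.Product.proj₂ y)
  ; _∙_     = λ x y → (proj₁ x G.∙ proj₁ y , Data.Product.proj₂ x H.∙ Data.Product.proj₂ y)
  }
  where
    module G = GrpLike G
    module H = GrpLike H

ℤ-grp : GrpLike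
ℤ-grp = record { Carrier = ℤ ; _≈_ = _≡_ ; _∙_ = ℤ._+_ }

trivial-grp : GrpLike
trivial-grp = record { Carrier = ⊤ ; _≈_ = λ _ _ → ⊤ ; _∙_ = λ _ _ → tt }

-- Reduced homology H̃_{l-2}(δ_λ) : cycles of length l modulo boundaries of
-- chains of length l+1.

Cycle : List ℕ → ℕ → Set
Cycle λ' l = Σ (Chain λ' l) λ c → ∀ w → ∂ (proj₁ c) w ≡ 0ℤ

Homologous : ∀ λ' l → Cycle λ' l → Cycle λ' l → Set
Homologous λ' l z z' =
  Σ (Chain λ' (suc l)) λ b →
    ∀ w → ∂ (proj₁ b) w ≡ proj₁ (proj₁ z) w ℤ.- proj₁ (proj₁ z') w

addCycle : ∀ λ' l → Cycle λ' l → Cycle λ' l → Cycle λ' l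
addCycle λ' l ((c , sc) , zc) ((d , sd) , zd) =
  ((λ w → c w ℤ.+ d w) , supp) , cyc
  where
    open import Relation.Binary.PropositionalEquality using (cong₂; trans)
    open import Data.Integer.Properties using (+-identityʳ; *-distribˡ-+; +-assoc; +-comm)
    supp : ∀ w → ¬ (InD λ' w × (length w ≡ l)) → c w ℤ.+ d w ≡ 0ℤ
    supp w h = trans (cong₂ ℤ._+_ (sc w h) (sd w h)) refl'
      where
        refl' : 0ℤ ℤ.+ 0ℤ ≡ 0ℤ
        refl' = Relation.Binary.PropositionalEquality.refl
    swap4 : ∀ a b x y → (a ℤ.+ b) ℤ.+ (x ℤ.+ y) ≡ (a ℤ.+ x) ℤ.+ (b ℤ.+ y)
    swap4 a b x y =
      trans (+-assoc a b (x ℤ.+ y))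
      (trans (cong₂ ℤ._+_ (Relation.Binary.PropositionalEquality.refl {x = a})
                (trans (Relation.Binary.PropositionalEquality.sym (+-assoc b x y))
                (trans (cong₂ ℤ._+_ (+-comm b x) (Relation.Binary.PropositionalEquality.refl {x = y}))
                       (+-assoc x b y))))
             (Relation.Binary.PropositionalEquality.sym (+-assoc a x (b ℤ.+ y))))
    lin : ∀ (xs : List (ℤ × List ℕ)) →
          sumℤ (List.map (λ p → proj₁ p ℤ.* (c (Data.Product.proj₂ p) ℤ.+ d (Data.Product.proj₂ p))) xs)
          ≡ sumℤ (List.map (λ p → proj₁ p ℤ.* c (Data.Product.proj₂ p)) xs)
            ℤ.+ sumℤ (List.map (λ p → proj₁ p ℤ.* d (Data.Product.proj₂ p)) xs)
    lin [] = Relation.Binary.PropositionalEquality.refl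
    lin ((s , v) ∷ xs) rewrite lin xs | *-distribˡ-+ s (c v) (d v) =
      swap4 (s ℤ.* c v) (s ℤ.* d v) _ _
    cyc : ∀ w → ∂ (λ w → c w ℤ.+ d w) w ≡ 0ℤ
    cyc w = trans (lin (refine w)) (cong₂ ℤ._+_ (zc w) (zd w))

H̃ : List ℕ → ℕ → GrpLike
H̃ λ' l = record
  { Carrier = Cycle λ' l
  ; _≈_     = Homologous λ' l
  ; _∙_     = addCycle λ' l
  }

-- the extra summand ℤ_(1): ℤ in reduced degree 1 (compositions of length 3)
Extra : ℕ → GrpLike
Extra l = if l ≡ᵇ 3 then ℤ-grp else trivial-grp

module Submission where

-- A composition w lies in D_λ iff its parts are the sums of the blocks of an ordered partition
-- of the parts of λ.  Summing the same blocks with the weights α̃ instead of α transfers words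
-- of D_λ to words of D_λ̃ and back.  As the resonances of α̃ are those of α together with
-- (F, ∁F), the resulting sums do not depend on the chosen partition, except that the two
-- vertices [A, B] and [B, A] of δ_λ (A, B the α-sums of F and ∁F) are both sent to the vertex
-- [m, m] of δ_λ̃.  The transfer commutes with the boundary, so the chain complexes of δ_λ̃ and
-- δ_λ agree, except that in δ_λ̃ the vertices [A, B] and [B, A] are identified.  For t ≥ 3
-- both complexes are connected, so the identification adds exactly one class in H̃₁: the
-- difference of two paths from [A, B] and [B, A] to a common base vertex, which closes up in δ_λ̃.

open import Defs
open import Data.Nat using (ℕ; _≤_; _<_)
open import Data.Vec using (Vec; toList)
open import Data.Fin.Subset using (Subset)
open import Data.Sum using (_⊎_)
open import Data.Product using (_×_)
open import Relation.Nullary using (¬_)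
open import Function.Bundles using (_⇔_)

open import Data.Bool using (true; false)
open import Data.Nat as ℕ using (zero; suc; _∸_; z≤n; s≤s)
import Data.Nat.Properties as ℕₚ
open import Data.Nat.Tactic.RingSolver using () renaming (solve-∀ to solveℕ-∀)
open import Data.Integer as ℤ using (ℤ; 0ℤ; 1ℤ; -1ℤ; -_; _+_; _*_; _-_)
import Data.Integer.Properties as ℤₚ
open import Data.Integer.Tactic.RingSolver using (solve-∀)
open import Data.Fin using (Fin; zero; suc)
open import Data.Fin.Subset using (Nonempty; Empty; _∈_; _∉_; _⊆_; _∩_; _∪_; _─_; ∁) renaming (⊥ to ∅; ⊤ to full)
open import Data.Fin.Subset.Properties
  using (∈⊤; ∉⊥; ⊥⊆; ⊆⊤; ⊆-refl; out⊆; drop-∷-Empty; drop-∷-⊆; Empty-unique; nonempty?; _⊆?_; anySubset?;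
         ∩-comm; x∈p∪q⁻; x∈p∩q⁻; x∈p∧x∉q⇒x∈p─q; x∈∁p⇒x∉p; x∉p⇒x∈∁p; p⊆p∪q; p─q⊆p; p─⊥≡p;
         p─q─r≡p─q∪r; p─q─r≡p─r─q)
open import Data.Vec as Vec using ([]; _∷_; here; there)
open import Data.List as List using (List; []; _∷_; _++_; length; upTo; applyUpTo)
import Data.List.Properties as Listₚ
open import Data.List.Relation.Unary.All as All using (All; []; _∷_)
open import Data.List.Relation.Unary.Any as Any using (Any)
open import Data.List.Membership.Propositional using () renaming (_∈_ to _∈ₗ_)
open import Data.List.Relation.Binary.Permutation.Propositional as ↭ using (_↭_)
import Data.List.Relation.Binary.Permutation.Propositional.Properties as ↭ₚ
open import Data.Product using (Σ; ∃-syntax; _,_; proj₁; proj₂; swap)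
open import Data.Sum using (inj₁; inj₂)
open import Data.Unit using (tt)
open import Data.Empty using (⊥; ⊥-elim)
open import Function using (_∘_)
open import Function.Bundles using (Equivalence)
open import Relation.Nullary using (Dec; yes; no; ¬?)
open import Relation.Nullary.Decidable using (_×-dec_)
open import Relation.Binary.PropositionalEquality

Σ< : ℕ → (ℕ → ℤ) → ℤ
Σ< zero    f = 0ℤ
Σ< (suc n) f = f 0 + Σ< n (f ∘ suc)

Σ<-congᵇ : ∀ n {f g} → (∀ i → i < n → f i ≡ g i) → Σ< n f ≡ Σ< n g
Σ<-congᵇ zero    f≗g = refl
Σ<-congᵇ (suc n) f≗g = cong₂ _+_ (f≗g 0 (s≤s z≤n)) (Σ<-congᵇ n (λ i i<n → f≗g (suc i) (s≤s i<n)))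

Σ<-cong : ∀ n {f g} → (∀ i → f i ≡ g i) → Σ< n f ≡ Σ< n g
Σ<-cong n f≗g = Σ<-congᵇ n (λ i _ → f≗g i)

Σ<-zeroᵇ : ∀ n {f} → (∀ i → i < n → f i ≡ 0ℤ) → Σ< n f ≡ 0ℤ
Σ<-zeroᵇ zero    f≗0 = refl
Σ<-zeroᵇ (suc n) f≗0 =
  cong₂ _+_ (f≗0 0 (s≤s z≤n)) (Σ<-zeroᵇ n (λ i i<n → f≗0 (suc i) (s≤s i<n)))

Σ<-zero : ∀ n {f} → (∀ i → f i ≡ 0ℤ) → Σ< n f ≡ 0ℤ
Σ<-zero n f≗0 = Σ<-zeroᵇ n (λ i _ → f≗0 i)

Σ<-+ : ∀ n f g → Σ< n (λ i → f i + g i) ≡ Σ< n f + Σ< n g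
Σ<-+ zero    f g = refl
Σ<-+ (suc n) f g rewrite Σ<-+ n (f ∘ suc) (g ∘ suc) =
  interchange (f 0) (g 0) (Σ< n (f ∘ suc)) (Σ< n (g ∘ suc))
  where
  interchange : ∀ a b c d → (a + b) + (c + d) ≡ (a + c) + (b + d)
  interchange = solve-∀

Σ<-neg : ∀ n f → Σ< n (λ i → - f i) ≡ - Σ< n f
Σ<-neg zero    f = refl
Σ<-neg (suc n) f rewrite Σ<-neg n (f ∘ suc) = sym (ℤₚ.neg-distrib-+ (f 0) (Σ< n (f ∘ suc)))

Σ<-*ˡ : ∀ n k f → Σ< n (λ i → k * f i) ≡ k * Σ< n f
Σ<-*ˡ zero    k f = sym (ℤₚ.*-zeroʳ k)
Σ<-*ˡ (suc n) k f rewrite Σ<-*ˡ n k (f ∘ suc) = sym (ℤₚ.*-distribˡ-+ k (f 0) (Σ< n (f ∘ suc)))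

Σ<-comm : ∀ n m (f : ℕ → ℕ → ℤ) → Σ< n (λ i → Σ< m (f i)) ≡ Σ< m (λ j → Σ< n (λ i → f i j))
Σ<-comm zero    m f = sym (Σ<-zero m (λ _ → refl))
Σ<-comm (suc n) m f rewrite Σ<-comm n m (f ∘ suc) = sym (Σ<-+ m (f 0) (λ j → Σ< n (λ i → f (suc i) j)))

Σ<-single : ∀ n p {f} → p < n → (∀ i → i < n → i ≢ p → f i ≡ 0ℤ) → Σ< n f ≡ f p
Σ<-single (suc n) zero    {f} _ off =
  trans (cong (f 0 +_) (Σ<-zeroᵇ n (λ i i<n → off (suc i) (s≤s i<n) λ ())))
        (ℤₚ.+-identityʳ (f 0))
Σ<-single (suc n) (suc p) {f} (s≤s p<n) off =
  trans (cong (_+ Σ< n (f ∘ suc)) (off 0 (s≤s z≤n) λ ()))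
        (trans (ℤₚ.+-identityˡ _) (Σ<-single n p p<n (λ i i<n i≢p → off (suc i) (s≤s i<n) (i≢p ∘ ℕₚ.suc-injective))))

Σ<-pair : ∀ n p q {f} → p ≢ q → p < n → q < n →
          (∀ i → i < n → i ≢ p → i ≢ q → f i ≡ 0ℤ) → Σ< n f ≡ f p + f q
Σ<-pair (suc n) zero zero p≢q _ _ _ = ⊥-elim (p≢q refl)
Σ<-pair (suc n) zero (suc q) {f} _ _ (s≤s q<n) off =
  cong (f 0 +_) (Σ<-single n q q<n (λ i i<n i≢q → off (suc i) (s≤s i<n) (λ ()) (i≢q ∘ ℕₚ.suc-injective)))
Σ<-pair (suc n) (suc p) zero {f} _ (s≤s p<n) _ off =
  trans (cong (f 0 +_) (Σ<-single n p p<n (λ i i<n i≢p → off (suc i) (s≤s i<n) (i≢p ∘ ℕₚ.suc-injective) (λ ()))))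
        (ℤₚ.+-comm (f 0) (f (suc p)))
Σ<-pair (suc n) (suc p) (suc q) {f} p≢q (s≤s p<n) (s≤s q<n) off =
  trans (cong (_+ Σ< n (f ∘ suc)) (off 0 (s≤s z≤n) (λ ()) (λ ())))
        (trans (ℤₚ.+-identityˡ _)
               (Σ<-pair n p q (p≢q ∘ cong suc) p<n q<n
                  (λ i i<n i≢p i≢q → off (suc i) (s≤s i<n) (i≢p ∘ ℕₚ.suc-injective) (i≢q ∘ ℕₚ.suc-injective))))

Σ<≢0⇒∃ : ∀ n f → Σ< n f ≢ 0ℤ → ∃[ i ] i < n × f i ≢ 0ℤ
Σ<≢0⇒∃ zero    f Σ≢0 = ⊥-elim (Σ≢0 refl)
Σ<≢0⇒∃ (suc n) f Σ≢0 with f 0 ℤ.≟ 0ℤ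
... | no  f0≢0 = 0 , s≤s z≤n , f0≢0
... | yes f0≡0 with Σ<≢0⇒∃ n (f ∘ suc) (λ rest≡0 → Σ≢0 (cong₂ _+_ f0≡0 rest≡0))
...   | i , i<n , fi≢0 = suc i , s≤s i<n , fi≢0

δ : ℕ → ℕ → ℤ → ℤ
δ i j X with i ℕ.≟ j
... | yes _ = X
... | no  _ = 0ℤ

δ-refl : ∀ i X → δ i i X ≡ X
δ-refl i X with i ℕ.≟ i
... | yes _   = refl
... | no  i≢i = ⊥-elim (i≢i refl)

δ-≢ : ∀ {i j} X → i ≢ j → δ i j X ≡ 0ℤ
δ-≢ {i} {j} X i≢j with i ℕ.≟ j
... | yes i≡j = ⊥-elim (i≢j i≡j)
... | no  _   = refl

δ-vanish : ∀ i j {X} → (i ≡ j → X ≡ 0ℤ) → δ i j X ≡ 0ℤ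
δ-vanish i j X≡0 with i ℕ.≟ j
... | yes i≡j = X≡0 i≡j
... | no  _   = refl

δ≢0 : ∀ i j {X} → δ i j X ≢ 0ℤ → i ≡ j × X ≢ 0ℤ
δ≢0 i j ≢0 with i ℕ.≟ j
... | yes i≡j = i≡j , ≢0
... | no  _   = ⊥-elim (≢0 refl)

δ-match : ∀ {i j i′ j′ X Y} → (i ≡ j → i′ ≡ j′ × X ≡ Y) → (i′ ≡ j′ → i ≡ j ⊎ Y ≡ 0ℤ) →
          δ i j X ≡ δ i′ j′ Y
δ-match {i} {j} {i′} {j′} ⇒ ⇐ with i ℕ.≟ j | i′ ℕ.≟ j′
... | yes i≡j | yes _    = proj₂ (⇒ i≡j)
... | yes i≡j | no i′≢j′ = ⊥-elim (i′≢j′ (proj₁ (⇒ i≡j)))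
... | no _    | no _     = refl
... | no i≢j  | yes i′≡j′ with ⇐ i′≡j′
...   | inj₁ i≡j = ⊥-elim (i≢j i≡j)
...   | inj₂ Y≡0 = sym Y≡0

Σ<-δ : ∀ n j X → j < n ⊎ X ≡ 0ℤ → Σ< n (λ i → δ i j X) ≡ X
Σ<-δ n j X (inj₁ j<n) = trans (Σ<-single n j j<n (λ i _ i≢j → δ-≢ X i≢j)) (δ-refl j X)
Σ<-δ n j X (inj₂ refl) = Σ<-zero n (λ i → δ-vanish i j (λ _ → refl))

-- Both sides equal the double sum of δ j (h i) (f i), whose terms are those of δ i (k j) (g j).
Σ<-reindex : ∀ n m (f g : ℕ → ℤ) (h k : ℕ → ℕ) →
  (∀ i → i < n → f i ≢ 0ℤ → h i < m × k (h i) ≡ i × g (h i) ≡ f i) →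
  (∀ j → j < m → g j ≢ 0ℤ → k j < n × h (k j) ≡ j × f (k j) ≡ g j) →
  Σ< n f ≡ Σ< m g
Σ<-reindex n m f g h k f→g g→f =
  begin
    Σ< n f
  ≡⟨ Σ<-congᵇ n (λ i i<n → sym (Σ<-δ m (h i) (f i) (inSupp-f i i<n))) ⟩
    Σ< n (λ i → Σ< m (λ j → δ j (h i) (f i)))
  ≡⟨ Σ<-comm n m _ ⟩
    Σ< m (λ j → Σ< n (λ i → δ j (h i) (f i)))
  ≡⟨ Σ<-congᵇ m (λ j j<m → Σ<-congᵇ n (λ i i<n → δ-swap i j i<n j<m)) ⟩
    Σ< m (λ j → Σ< n (λ i → δ i (k j) (g j)))
  ≡⟨ Σ<-congᵇ m (λ j j<m → Σ<-δ n (k j) (g j) (inSupp-g j j<m)) ⟩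
    Σ< m g
  ∎
  where
  open ≡-Reasoning
  inSupp-f : ∀ i → i < n → h i < m ⊎ f i ≡ 0ℤ
  inSupp-f i i<n with f i ℤ.≟ 0ℤ
  ... | yes fi≡0 = inj₂ fi≡0
  ... | no  fi≢0 = inj₁ (proj₁ (f→g i i<n fi≢0))
  inSupp-g : ∀ j → j < m → k j < n ⊎ g j ≡ 0ℤ
  inSupp-g j j<m with g j ℤ.≟ 0ℤ
  ... | yes gj≡0 = inj₂ gj≡0
  ... | no  gj≢0 = inj₁ (proj₁ (g→f j j<m gj≢0))
  δ-swap : ∀ i j → i < n → j < m → δ j (h i) (f i) ≡ δ i (k j) (g j)
  δ-swap i j i<n j<m with f i ℤ.≟ 0ℤ
  ... | yes fi≡0 = trans (δ-vanish j (h i) (λ _ → fi≡0)) (sym (δ-vanish i (k j) g-vanishes))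
    where
    g-vanishes : i ≡ k j → g j ≡ 0ℤ
    g-vanishes i≡kj with g j ℤ.≟ 0ℤ
    ... | yes gj≡0 = gj≡0
    ... | no  gj≢0 = trans (sym (proj₂ (proj₂ (g→f j j<m gj≢0)))) (trans (cong f (sym i≡kj)) fi≡0)
  ... | no fi≢0 = δ-match on-graph off-graph
    where
    on-graph : j ≡ h i → i ≡ k j × f i ≡ g j
    on-graph refl = sym (proj₁ (proj₂ (f→g i i<n fi≢0))) , sym (proj₂ (proj₂ (f→g i i<n fi≢0)))
    off-graph : i ≡ k j → j ≡ h i ⊎ g j ≡ 0ℤ
    off-graph i≡kj with g j ℤ.≟ 0ℤ
    ... | yes gj≡0 = inj₂ gj≡0
    ... | no  gj≢0 = inj₁ (trans (sym (proj₁ (proj₂ (g→f j j<m gj≢0)))) (cong h (sym i≡kj)))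

-- The boundary operator

sumℤ-map-++ : ∀ {A : Set} (f : A → ℤ) xs ys →
              sumℤ (List.map f (xs ++ ys)) ≡ sumℤ (List.map f xs) + sumℤ (List.map f ys)
sumℤ-map-++ f []       ys = sym (ℤₚ.+-identityˡ _)
sumℤ-map-++ f (x ∷ xs) ys rewrite sumℤ-map-++ f xs ys = sym (ℤₚ.+-assoc (f x) _ _)

sumℤ-map-neg : ∀ {A : Set} (f : A → ℤ) xs → sumℤ (List.map (λ x → - f x) xs) ≡ - sumℤ (List.map f xs)
sumℤ-map-neg f []       = refl
sumℤ-map-neg f (x ∷ xs) rewrite sumℤ-map-neg f xs = sym (ℤₚ.neg-distrib-+ (f x) _)

sumℤ-applyUpTo : ∀ (g : ℕ → ℤ) f n → sumℤ (List.map g (applyUpTo f n)) ≡ Σ< n (g ∘ f)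
sumℤ-applyUpTo g f zero    = refl
sumℤ-applyUpTo g f (suc n) = cong (g (f 0) +_) (sumℤ-applyUpTo g (f ∘ suc) n)

∂-∷ : ∀ c m w → ∂ c (m ∷ w) ≡ Σ< (m ∸ 1) (λ a → c (suc a ∷ (m ∸ suc a) ∷ w)) - ∂ (c ∘ (m ∷_)) w
∂-∷ c m w =
  begin
    ∂ c (m ∷ w)
  ≡⟨ sumℤ-map-++ term (List.map _ (splits m)) (List.map _ (refine w)) ⟩
    sumℤ (List.map term (List.map _ (splits m))) + sumℤ (List.map term (List.map _ (refine w)))
  ≡⟨ cong₂ _+_ (cong sumℤ (trans (sym (Listₚ.map-∘ (splits m))) (sym (Listₚ.map-∘ (upTo (m ∸ 1))))))
               (cong sumℤ (trans (sym (Listₚ.map-∘ (refine w)))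
                                 (Listₚ.map-cong (λ p → sym (ℤₚ.neg-distribˡ-* (proj₁ p) _)) (refine w)))) ⟩
    sumℤ (List.map (λ a → 1ℤ * c (suc a ∷ (m ∸ suc a) ∷ w)) (upTo (m ∸ 1)))
      + sumℤ (List.map (λ p → - (proj₁ p * c (m ∷ proj₂ p))) (refine w))
  ≡⟨ cong₂ _+_ (trans (sumℤ-applyUpTo _ (λ a → a) (m ∸ 1)) (Σ<-cong (m ∸ 1) (λ _ → ℤₚ.*-identityˡ _)))
               (sumℤ-map-neg _ (refine w)) ⟩
    Σ< (m ∸ 1) (λ a → c (suc a ∷ (m ∸ suc a) ∷ w)) - ∂ (c ∘ (m ∷_)) w
  ∎
  where
  open ≡-Reasoning
  term : ℤ × List ℕ → ℤ
  term p = proj₁ p * c (proj₂ p)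

∂-cong : ∀ f g w → (∀ v → f v ≡ g v) → ∂ f w ≡ ∂ g w
∂-cong f g w f≗g = cong sumℤ (Listₚ.map-cong (λ p → cong (proj₁ p *_) (f≗g (proj₂ p))) (refine w))

∂-cong-length : ∀ f g w → (∀ v → length v ≡ suc (length w) → f v ≡ g v) → ∂ f w ≡ ∂ g w
∂-cong-length f g []      f≗g = refl
∂-cong-length f g (m ∷ w) f≗g rewrite ∂-∷ f m w | ∂-∷ g m w =
  cong₂ _-_ (Σ<-cong (m ∸ 1) (λ _ → f≗g _ refl))
            (∂-cong-length (f ∘ (m ∷_)) (g ∘ (m ∷_)) w (λ v |v| → f≗g (m ∷ v) (cong suc |v|)))

∂-zero : ∀ w → ∂ (λ _ → 0ℤ) w ≡ 0ℤ
∂-zero []      = refl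
∂-zero (m ∷ w) rewrite ∂-∷ (λ _ → 0ℤ) m w | ∂-zero w | Σ<-zero (m ∸ 1) {λ _ → 0ℤ} (λ _ → refl) = refl

∂-length : ∀ L c w → (∀ v → length v ≢ L → c v ≡ 0ℤ) → suc (length w) ≢ L → ∂ c w ≡ 0ℤ
∂-length L c w c-supp |w|+1≢L =
  trans (∂-cong-length c (λ _ → 0ℤ) w (λ v |v| → c-supp v (|w|+1≢L ∘ trans (sym |v|)))) (∂-zero w)

∂-+ : ∀ f g w → ∂ (λ v → f v + g v) w ≡ ∂ f w + ∂ g w
∂-+ f g []      = refl
∂-+ f g (m ∷ w) rewrite ∂-∷ (λ v → f v + g v) m w | ∂-∷ f m w | ∂-∷ g m w
  | ∂-+ (f ∘ (m ∷_)) (g ∘ (m ∷_)) w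
  | Σ<-+ (m ∸ 1) (λ a → f (suc a ∷ (m ∸ suc a) ∷ w)) (λ a → g (suc a ∷ (m ∸ suc a) ∷ w)) =
  interchange (Σ< (m ∸ 1) (λ a → f (suc a ∷ (m ∸ suc a) ∷ w))) (Σ< (m ∸ 1) (λ a → g (suc a ∷ (m ∸ suc a) ∷ w)))
              (∂ (f ∘ (m ∷_)) w) (∂ (g ∘ (m ∷_)) w)
  where
  interchange : ∀ a b c d → (a + b) - (c + d) ≡ (a - c) + (b - d)
  interchange = solve-∀

∂-*ˡ : ∀ k f w → ∂ (λ v → k * f v) w ≡ k * ∂ f w
∂-*ˡ k f []      = sym (ℤₚ.*-zeroʳ k)
∂-*ˡ k f (m ∷ w) rewrite ∂-∷ (λ v → k * f v) m w | ∂-∷ f m w | ∂-*ˡ k (f ∘ (m ∷_)) w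
  | Σ<-*ˡ (m ∸ 1) k (λ a → f (suc a ∷ (m ∸ suc a) ∷ w)) =
  distrib k (Σ< (m ∸ 1) (λ a → f (suc a ∷ (m ∸ suc a) ∷ w))) (∂ (f ∘ (m ∷_)) w)
  where
  distrib : ∀ k a b → k * a - k * b ≡ k * (a - b)
  distrib = solve-∀

∂-Σ< : ∀ n (f : ℕ → List ℕ → ℤ) w → ∂ (λ v → Σ< n (λ i → f i v)) w ≡ Σ< n (λ i → ∂ (f i) w)
∂-Σ< zero    f w = ∂-zero w
∂-Σ< (suc n) f w = trans (∂-+ (f 0) (λ v → Σ< n (λ i → f (suc i) v)) w) (cong (∂ (f 0) w +_) (∂-Σ< n (f ∘ suc) w))

∂-neg : ∀ f w → ∂ (λ v → - f v) w ≡ - ∂ f w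
∂-neg f w = trans (∂-cong _ (λ v → -1ℤ * f v) w (λ v → sym (ℤₚ.-1*i≡-i (f v))))
                  (trans (∂-*ˡ -1ℤ f w) (ℤₚ.-1*i≡-i _))

∂-- : ∀ f g w → ∂ (λ v → f v - g v) w ≡ ∂ f w - ∂ g w
∂-- f g w = trans (∂-+ f (λ v → - g v) w) (cong (∂ f w +_) (∂-neg g w))

Σ<-triangle : ∀ n (g : ℕ → ℕ → ℤ) →
              Σ< n (λ j → Σ< j (λ i → g i j)) ≡ Σ< n (λ i → Σ< (n ∸ i ∸ 1) (λ b → g i (i ℕ.+ suc b)))
Σ<-triangle zero    g = refl
Σ<-triangle (suc n) g =
  trans (ℤₚ.+-identityˡ _)
        (trans (Σ<-+ n (λ j → g 0 (suc j)) (λ j → Σ< j (λ i → g (suc i) (suc j))))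
               (cong (Σ< n (λ j → g 0 (suc j)) +_) (Σ<-triangle n (λ i j → g (suc i) (suc j)))))

∂∂ : ∀ c w → ∂ (∂ c) w ≡ 0ℤ
∂∂ c []      = refl
∂∂ c (m ∷ w) =
  begin
    ∂ (∂ c) (m ∷ w)
  ≡⟨ ∂-∷ (∂ c) m w ⟩
    Σ< (m ∸ 1) (λ a → ∂ c (suc a ∷ (m ∸ suc a) ∷ w)) - ∂ (∂ c ∘ (m ∷_)) w
  ≡⟨ cong₂ _-_ (Σ<-cong (m ∸ 1) ∂c-unfold) ∂∂c-unfold ⟩
    Σ< (m ∸ 1) (λ a → P a - (Q a - R a)) - (Σ< (m ∸ 1) R - 0ℤ)
  ≡⟨ cong (_- (Σ< (m ∸ 1) R - 0ℤ)) (Σ<-linear (m ∸ 1)) ⟩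
    (Σ< (m ∸ 1) P - (Σ< (m ∸ 1) Q - Σ< (m ∸ 1) R)) - (Σ< (m ∸ 1) R - 0ℤ)
  ≡⟨ cong (λ X → (X - (Σ< (m ∸ 1) Q - Σ< (m ∸ 1) R)) - (Σ< (m ∸ 1) R - 0ℤ)) ΣP≡ΣQ ⟩
    (Σ< (m ∸ 1) Q - (Σ< (m ∸ 1) Q - Σ< (m ∸ 1) R)) - (Σ< (m ∸ 1) R - 0ℤ)
  ≡⟨ cancel (Σ< (m ∸ 1) Q) (Σ< (m ∸ 1) R) ⟩
    0ℤ
  ∎
  where
  open ≡-Reasoning
  -- the refinements of [a+1, m-a-1] ++ w splitting its first part, its second part, or a part of w
  P Q R : ℕ → ℤ
  P a = Σ< a (λ a′ → c (suc a′ ∷ (suc a ∸ suc a′) ∷ (m ∸ suc a) ∷ w))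
  Q a = Σ< (m ∸ suc a ∸ 1) (λ b → c (suc a ∷ suc b ∷ (m ∸ suc a ∸ suc b) ∷ w))
  R a = ∂ (λ v → c (suc a ∷ (m ∸ suc a) ∷ v)) w
  ∂c-unfold : ∀ a → ∂ c (suc a ∷ (m ∸ suc a) ∷ w) ≡ P a - (Q a - R a)
  ∂c-unfold a = trans (∂-∷ c (suc a) ((m ∸ suc a) ∷ w)) (cong (λ x → P a - x) (∂-∷ (c ∘ (suc a ∷_)) (m ∸ suc a) w))
  ∂∂c-unfold : ∂ (∂ c ∘ (m ∷_)) w ≡ Σ< (m ∸ 1) R - 0ℤ
  ∂∂c-unfold =
    trans (∂-cong _ (λ v → Σ< (m ∸ 1) (λ a → c (suc a ∷ (m ∸ suc a) ∷ v)) - ∂ (c ∘ (m ∷_)) v) w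
                  (λ v → ∂-∷ c m v))
          (trans (∂-- _ _ w) (cong₂ _-_ (∂-Σ< (m ∸ 1) (λ a v → c (suc a ∷ (m ∸ suc a) ∷ v)) w)
                                        (∂∂ (c ∘ (m ∷_)) w)))
  Σ<-linear : ∀ n → Σ< n (λ a → P a - (Q a - R a)) ≡ Σ< n P - (Σ< n Q - Σ< n R)
  Σ<-linear n =
    trans (Σ<-+ n P (λ a → - (Q a - R a)))
          (cong (Σ< n P +_) (trans (Σ<-neg n (λ a → Q a - R a))
                                   (cong -_ (trans (Σ<-+ n Q (λ a → - R a)) (cong (Σ< n Q +_) (Σ<-neg n R))))))
  ΣP≡ΣQ : Σ< (m ∸ 1) P ≡ Σ< (m ∸ 1) Q
  ΣP≡ΣQ =
    trans (Σ<-triangle (m ∸ 1) (λ a′ a → c (suc a′ ∷ (suc a ∸ suc a′) ∷ (m ∸ suc a) ∷ w)))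
          (Σ<-cong (m ∸ 1) λ a →
             trans (Σ<-cong (m ∸ 1 ∸ a ∸ 1) (λ b → cong₂ (λ x y → c (suc a ∷ x ∷ y ∷ w))
                                                       (ℕₚ.m+n∸m≡n a (suc b))
                                                       (sym (ℕₚ.∸-+-assoc m (suc a) (suc b)))))
                   (cong (λ k → Σ< (k ∸ 1) (λ b → c (suc a ∷ suc b ∷ (m ∸ suc a ∸ suc b) ∷ w)))
                         (ℕₚ.∸-+-assoc m 1 a)))
  cancel : ∀ q r → (q - (q - r)) - (r - 0ℤ) ≡ 0ℤ
  cancel = solve-∀

part : List ℕ → ℕ → ℕ
part []      j       = 0
part (m ∷ w) zero    = m
part (m ∷ w) (suc j) = part w j

split : ℕ → List ℕ → ℕ → List ℕ
split j       []      a = []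
split zero    (m ∷ w) a = a ∷ (m ∸ a) ∷ w
split (suc j) (m ∷ w) a = m ∷ split j w a

merge : ℕ → List ℕ → List ℕ
merge j       []            = []
merge j       (x ∷ [])      = x ∷ []
merge zero    (x ∷ y ∷ u)   = (x ℕ.+ y) ∷ u
merge (suc j) (x ∷ y ∷ u)   = x ∷ merge j (y ∷ u)

signed : ℕ → ℤ → ℤ
signed zero    x = x
signed (suc j) x = - signed j x

signed-zero : ∀ j → signed j 0ℤ ≡ 0ℤ
signed-zero zero    = refl
signed-zero (suc j) = cong -_ (signed-zero j)

∂-positional : ∀ c w → ∂ c w ≡ Σ< (length w) (λ j → signed j (Σ< (part w j ∸ 1) (λ a → c (split j w (suc a)))))
∂-positional c []      = refl
∂-positional c (m ∷ w) rewrite ∂-∷ c m w | ∂-positional (c ∘ (m ∷_)) w =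
  cong (Σ< (m ∸ 1) (λ a → c (suc a ∷ (m ∸ suc a) ∷ w)) +_)
       (sym (Σ<-neg (length w) (λ j → signed j (Σ< (part w j ∸ 1) (λ a → c (m ∷ split j w (suc a)))))))

split-length : ∀ j w a → j < length w → length (split j w a) ≡ suc (length w)
split-length zero    (m ∷ w) a _         = refl
split-length (suc j) (m ∷ w) a (s≤s j<) = cong suc (split-length j w a j<)

merge-split : ∀ j w a → j < length w → a ≤ part w j → merge j (split j w a) ≡ w
merge-split zero          (m ∷ w)     a _         a≤m = cong (_∷ w) (ℕₚ.m+[n∸m]≡n a≤m)
merge-split (suc zero)    (m ∷ n ∷ w) a (s≤s j<) a≤n = cong (m ∷_) (merge-split zero (n ∷ w) a j< a≤n)
merge-split (suc (suc j)) (m ∷ n ∷ w) a (s≤s j<) a≤ = cong (m ∷_) (merge-split (suc j) (n ∷ w) a j< a≤)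

split-merge : ∀ j u → suc j < length u → split j (merge j u) (part u j) ≡ u
split-merge zero    (x ∷ y ∷ u)     _         = cong (λ z → x ∷ z ∷ u) (ℕₚ.m+n∸m≡n x y)
split-merge (suc j) (x ∷ y ∷ z ∷ u) (s≤s j<) = cong (x ∷_) (split-merge j (y ∷ z ∷ u) j<)
split-merge zero    (x ∷ [])        (s≤s ())
split-merge (suc j) (x ∷ y ∷ [])    (s≤s (s≤s ()))

part-split : ∀ j w a → j < length w → part (split j w a) j ≡ a
part-split zero    (m ∷ w) a _         = refl
part-split (suc j) (m ∷ w) a (s≤s j<) = part-split j w a j<

part-merge : ∀ j u → suc j < length u → part (merge j u) j ≡ part u j ℕ.+ part u (suc j)
part-merge zero    (x ∷ y ∷ u)     _         = refl
part-merge (suc j) (x ∷ y ∷ z ∷ u) (s≤s j<) = part-merge j (y ∷ z ∷ u) j<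
part-merge zero    (x ∷ [])        (s≤s ())
part-merge (suc j) (x ∷ y ∷ [])    (s≤s (s≤s ()))

∂-[_] : ∀ n f → ∂ f (n ∷ []) ≡ Σ< (n ∸ 1) (λ i → f (suc i ∷ (n ∸ suc i) ∷ []))
∂-[ n ] f = trans (∂-∷ f n []) (ℤₚ.+-identityʳ _)

𝟙[_] : List ℕ → List ℕ → ℤ
𝟙[ []    ] []      = 1ℤ
𝟙[ x ∷ v ] (p ∷ w) = δ p x (𝟙[ v ] w)
𝟙[ _     ] _       = 0ℤ

𝟙-refl : ∀ v → 𝟙[ v ] v ≡ 1ℤ
𝟙-refl []      = refl
𝟙-refl (x ∷ v) = trans (δ-refl x _) (𝟙-refl v)

𝟙≢0⇒≡ : ∀ v w → 𝟙[ v ] w ≢ 0ℤ → v ≡ w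
𝟙≢0⇒≡ []      []      _   = refl
𝟙≢0⇒≡ []      (_ ∷ _) ≢0 = ⊥-elim (≢0 refl)
𝟙≢0⇒≡ (x ∷ v) []      ≢0 = ⊥-elim (≢0 refl)
𝟙≢0⇒≡ (x ∷ v) (p ∷ w) ≢0 with δ≢0 p x ≢0
... | p≡x , ≢0′ = cong₂ _∷_ (sym p≡x) (𝟙≢0⇒≡ v w ≢0′)

𝟙-≢ : ∀ v w → v ≢ w → 𝟙[ v ] w ≡ 0ℤ
𝟙-≢ v w v≢w with 𝟙[ v ] w ℤ.≟ 0ℤ
... | yes ≡0 = ≡0
... | no  ≢0 = ⊥-elim (v≢w (𝟙≢0⇒≡ v w ≢0))

-- exactly one way of splitting the first part p of p ∷ w gives x ∷ y ∷ v
Σ<-𝟙-split : ∀ x y v p w → 1 ≤ x → 1 ≤ y →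
             Σ< (p ∸ 1) (λ a → 𝟙[ x ∷ y ∷ v ] (suc a ∷ (p ∸ suc a) ∷ w)) ≡ 𝟙[ (x ℕ.+ y) ∷ v ] (p ∷ w)
Σ<-𝟙-split x y v p w 1≤x 1≤y = by-cases (p ℕ.≟ x ℕ.+ y)
  where
  by-cases : Dec (p ≡ x ℕ.+ y) →
             Σ< (p ∸ 1) (λ a → 𝟙[ x ∷ y ∷ v ] (suc a ∷ (p ∸ suc a) ∷ w)) ≡ 𝟙[ (x ℕ.+ y) ∷ v ] (p ∷ w)
  by-cases (yes refl) =
    trans (Σ<-single (x ℕ.+ y ∸ 1) (x ∸ 1) x-1< (λ a _ a≢ → δ-≢ _ (a≢ ∘ suc-a≡x⇒)))
          (trans (cong₂ (λ s r → δ s x (δ r y (𝟙[ v ] w))) sx (trans (cong (x ℕ.+ y ∸_) sx) (ℕₚ.m+n∸m≡n x y)))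
                 (trans (δ-refl x _) (trans (δ-refl y _) (sym (δ-refl (x ℕ.+ y) _)))))
    where
    sx : suc (x ∸ 1) ≡ x
    sx = ℕₚ.m+[n∸m]≡n 1≤x
    suc-a≡x⇒ : ∀ {a} → suc a ≡ x → a ≡ x ∸ 1
    suc-a≡x⇒ refl = refl
    x-1< : x ∸ 1 < x ℕ.+ y ∸ 1
    x-1< = ℕₚ.∸-monoˡ-< (ℕₚ.m<m+n x 1≤y) 1≤x
  by-cases (no p≢x+y) = trans (Σ<-zeroᵇ (p ∸ 1) term≡0) (sym (δ-≢ _ p≢x+y))
    where
    term≡0 : ∀ a → a < p ∸ 1 → 𝟙[ x ∷ y ∷ v ] (suc a ∷ (p ∸ suc a) ∷ w) ≡ 0ℤ
    term≡0 a a< = δ-vanish (suc a) x (λ { refl → δ-vanish (p ∸ suc a) y (λ { refl →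
                    ⊥-elim (p≢x+y (sym (ℕₚ.m+[n∸m]≡n (ℕₚ.≤-trans a< (ℕₚ.m∸n≤m p 1)))) ) }) })

∂-δ : ∀ i j (f : List ℕ → ℤ) w → ∂ (λ u → δ i j (f u)) w ≡ δ i j (∂ f w)
∂-δ i j f w with i ℕ.≟ j
... | yes _ = refl
... | no  _ = ∂-zero w

δ-signed-Σ< : ∀ i j n (f : ℕ → ℤ) → δ i j (Σ< n (λ k → signed k (f k))) ≡ Σ< n (λ k → signed k (δ i j (f k)))
δ-signed-Σ< i j n f with i ℕ.≟ j
... | yes _ = refl
... | no  _ = sym (Σ<-zero n (λ k → signed-zero k))

𝟙-[] : ∀ j x v → 𝟙[ merge j (x ∷ v) ] [] ≡ 0ℤ
𝟙-[] j       x []      = refl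
𝟙-[] zero    x (y ∷ v) = refl
𝟙-[] (suc j) x (y ∷ v) = refl

∂-𝟙 : ∀ v → All (1 ≤_) v → ∀ w → ∂ 𝟙[ v ] w ≡ Σ< (length v ∸ 1) (λ j → signed j (𝟙[ merge j v ] w))
∂-𝟙 []          _                   w       =
  ∂-length 0 𝟙[ [] ] w (λ u |u|≢0 → 𝟙-≢ [] u (|u|≢0 ∘ cong length ∘ sym)) (λ ())
∂-𝟙 (x ∷ [])    _                   []      = refl
∂-𝟙 (x ∷ [])    _                   (p ∷ w) =
  ∂-length 1 𝟙[ x ∷ [] ] (p ∷ w) (λ u |u|≢1 → 𝟙-≢ (x ∷ []) u (|u|≢1 ∘ cong length ∘ sym)) (λ ())
∂-𝟙 (x ∷ y ∷ v) _                   []      =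
  sym (Σ<-zero (suc (length v)) (λ j → trans (cong (signed j) (𝟙-[] j x (y ∷ v))) (signed-zero j)))
∂-𝟙 (x ∷ y ∷ v) (1≤x ∷ 1≤y ∷ v⁺)   (p ∷ w) =
  begin
    ∂ 𝟙[ x ∷ y ∷ v ] (p ∷ w)
  ≡⟨ ∂-∷ 𝟙[ x ∷ y ∷ v ] p w ⟩
    Σ< (p ∸ 1) (λ a → 𝟙[ x ∷ y ∷ v ] (suc a ∷ (p ∸ suc a) ∷ w)) - ∂ (λ u → δ p x (𝟙[ y ∷ v ] u)) w
  ≡⟨ cong₂ _-_ (Σ<-𝟙-split x y v p w 1≤x 1≤y) (∂-δ p x 𝟙[ y ∷ v ] w) ⟩
    𝟙[ (x ℕ.+ y) ∷ v ] (p ∷ w) - δ p x (∂ 𝟙[ y ∷ v ] w)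
  ≡⟨ cong (λ d → 𝟙[ (x ℕ.+ y) ∷ v ] (p ∷ w) - δ p x d) (∂-𝟙 (y ∷ v) (1≤y ∷ v⁺) w) ⟩
    𝟙[ (x ℕ.+ y) ∷ v ] (p ∷ w) - δ p x (Σ< (length v) (λ j → signed j (𝟙[ merge j (y ∷ v) ] w)))
  ≡⟨ cong (λ d → 𝟙[ (x ℕ.+ y) ∷ v ] (p ∷ w) - d) (δ-signed-Σ< p x (length v) (λ j → 𝟙[ merge j (y ∷ v) ] w)) ⟩
    𝟙[ (x ℕ.+ y) ∷ v ] (p ∷ w) - Σ< (length v) (λ j → signed j (𝟙[ merge (suc j) (x ∷ y ∷ v) ] (p ∷ w)))
  ≡⟨ cong (𝟙[ (x ℕ.+ y) ∷ v ] (p ∷ w) +_) (sym (Σ<-neg (length v) _)) ⟩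
    Σ< (suc (length v)) (λ j → signed j (𝟙[ merge j (x ∷ y ∷ v) ] (p ∷ w)))
  ∎
  where open ≡-Reasoning

-- Ordered partitions

private
  interchange : ∀ x p q → x ℕ.+ (p ℕ.+ q) ≡ p ℕ.+ (x ℕ.+ q)
  interchange = solveℕ-∀

x∈p─q⇒x∉q : ∀ {t} {x : Fin t} (p q : Subset t) → x ∈ p ─ q → x ∉ q
x∈p─q⇒x∉q (_ ∷ p) (false ∷ q) here       ()
x∈p─q⇒x∉q (_ ∷ p) (true ∷ q)  ()         here
x∈p─q⇒x∉q (_ ∷ p) (_ ∷ q)     (there x∈) (there x∈q) = x∈p─q⇒x∉q p q x∈ x∈q

Nonempty-∷ : ∀ {t} {s} {S : Subset t} → Nonempty S → Nonempty (s ∷ S)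
Nonempty-∷ (i , i∈S) = suc i , there i∈S

sumSub-∅ : ∀ {t} (a : Vec ℕ t) → sumSub a ∅ ≡ 0
sumSub-∅ []      = refl
sumSub-∅ (x ∷ a) = sumSub-∅ a

sumSub-⁅0⁆ : ∀ {t} x (a : Vec ℕ t) → sumSub (x ∷ a) (true ∷ ∅) ≡ x
sumSub-⁅0⁆ x a = trans (cong (x ℕ.+_) (sumSub-∅ a)) (ℕₚ.+-identityʳ x)

⁅0⁆⊆ : ∀ {t} {R : Subset t} → true ∷ ∅ ⊆ true ∷ R
⁅0⁆⊆ here        = here
⁅0⁆⊆ (there x∈∅) = ⊥-elim (∉⊥ x∈∅)

sumSub-Empty : ∀ {t} (a : Vec ℕ t) {B} → Empty B → sumSub a B ≡ 0
sumSub-Empty a B-empty rewrite Empty-unique B-empty = sumSub-∅ a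

sumSub-pos : ∀ {t} (a : Vec ℕ t) {B} → AllPos a → Nonempty B → 1 ≤ sumSub a B
sumSub-pos (x ∷ a) {true ∷ B}  (1≤x , _) _               = ℕₚ.≤-trans 1≤x (ℕₚ.m≤m+n x _)
sumSub-pos (x ∷ a) {false ∷ B} (_ , a⁺)  (suc i , there i∈B) = sumSub-pos a a⁺ (i , i∈B)

sumSub≡0⇒Empty : ∀ {t} (a : Vec ℕ t) {B} → AllPos a → sumSub a B ≡ 0 → Empty B
sumSub≡0⇒Empty a a⁺ ΣB≡0 B-nonempty with sumSub-pos a a⁺ B-nonempty
... | 1≤ΣB rewrite ΣB≡0 with 1≤ΣB
...   | ()

sumSub-∪ : ∀ {t} (a : Vec ℕ t) B C → Disjoint B C → sumSub a (B ∪ C) ≡ sumSub a B ℕ.+ sumSub a C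
sumSub-∪ []      []          []          _ = refl
sumSub-∪ (x ∷ a) (true ∷ B)  (true ∷ C)  B∩C-empty = ⊥-elim (B∩C-empty (zero , here))
sumSub-∪ (x ∷ a) (true ∷ B)  (false ∷ C) B∩C-empty =
  trans (cong (x ℕ.+_) (sumSub-∪ a B C (drop-∷-Empty B∩C-empty))) (sym (ℕₚ.+-assoc x _ _))
sumSub-∪ (x ∷ a) (false ∷ B) (true ∷ C)  B∩C-empty =
  trans (cong (x ℕ.+_) (sumSub-∪ a B C (drop-∷-Empty B∩C-empty))) (interchange x (sumSub a B) (sumSub a C))
sumSub-∪ (x ∷ a) (false ∷ B) (false ∷ C) B∩C-empty = sumSub-∪ a B C (drop-∷-Empty B∩C-empty)

sumSub-∩─ : ∀ {t} (a : Vec ℕ t) B C → sumSub a B ≡ sumSub a (B ∩ C) ℕ.+ sumSub a (B ─ C)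
sumSub-∩─ []      []          []          = refl
sumSub-∩─ (x ∷ a) (true ∷ B)  (true ∷ C)  = trans (cong (x ℕ.+_) (sumSub-∩─ a B C)) (sym (ℕₚ.+-assoc x _ _))
sumSub-∩─ (x ∷ a) (true ∷ B)  (false ∷ C) =
  trans (cong (x ℕ.+_) (sumSub-∩─ a B C)) (interchange x (sumSub a (B ∩ C)) (sumSub a (B ─ C)))
sumSub-∩─ (x ∷ a) (false ∷ B) (true ∷ C)  = sumSub-∩─ a B C
sumSub-∩─ (x ∷ a) (false ∷ B) (false ∷ C) = sumSub-∩─ a B C

sumSub-⊆ : ∀ {t} (a : Vec ℕ t) B R → B ⊆ R → sumSub a R ≡ sumSub a B ℕ.+ sumSub a (R ─ B)
sumSub-⊆ []      []          []          _   = refl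
sumSub-⊆ (x ∷ a) (true ∷ B)  (true ∷ R)  B⊆R =
  trans (cong (x ℕ.+_) (sumSub-⊆ a B R (drop-∷-⊆ B⊆R))) (sym (ℕₚ.+-assoc x _ _))
sumSub-⊆ (x ∷ a) (true ∷ B)  (false ∷ R) B⊆R with B⊆R here
... | ()
sumSub-⊆ (x ∷ a) (false ∷ B) (true ∷ R)  B⊆R =
  trans (cong (x ℕ.+_) (sumSub-⊆ a B R (drop-∷-⊆ B⊆R))) (interchange x (sumSub a B) (sumSub a (R ─ B)))
sumSub-⊆ (x ∷ a) (false ∷ B) (false ∷ R) B⊆R = sumSub-⊆ a B R (drop-∷-⊆ B⊆R)

sumSub-∁ : ∀ {t} (a : Vec ℕ t) F → sumSub a full ≡ sumSub a F ℕ.+ sumSub a (∁ F)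
sumSub-∁ []      []          = refl
sumSub-∁ (x ∷ a) (true ∷ F)  = trans (cong (x ℕ.+_) (sumSub-∁ a F)) (sym (ℕₚ.+-assoc x _ _))
sumSub-∁ (x ∷ a) (false ∷ F) = trans (cong (x ℕ.+_) (sumSub-∁ a F)) (interchange x (sumSub a F) (sumSub a (∁ F)))

-- the parts of w are the a-sums of the blocks of an ordered partition of R into nonempty blocks;
-- for R = full this says that w ∈ D_λ, see Realisable⇒InD and InD⇒Realisable
OrderedPartition : ∀ {t} → Vec ℕ t → Subset t → List ℕ → Set
OrderedPartition a R []      = Empty R
OrderedPartition a R (x ∷ w) = ∃[ B ] B ⊆ R × Nonempty B × sumSub a B ≡ x × OrderedPartition a (R ─ B) w

orderedPartition? : ∀ {t} (a : Vec ℕ t) R w → Dec (OrderedPartition a R w)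
orderedPartition? a R []      = ¬? (nonempty? R)
orderedPartition? a R (x ∷ w) =
  anySubset? (λ B → (B ⊆? R) ×-dec nonempty? B ×-dec (sumSub a B ℕ.≟ x) ×-dec orderedPartition? a (R ─ B) w)

Realisable : ∀ {t} → Vec ℕ t → List ℕ → Set
Realisable a w = OrderedPartition a full w

blockSums : ∀ {t} {a : Vec ℕ t} (b : Vec ℕ t) {R} w → OrderedPartition a R w → List ℕ
blockSums b []      _                   = []
blockSums b (x ∷ w) (B , _ , _ , _ , p) = sumSub b B ∷ blockSums b w p

reweight : ∀ {t} {a : Vec ℕ t} (b : Vec ℕ t) {R} w (p : OrderedPartition a R w) →
           OrderedPartition b R (blockSums b w p)
reweight b []      p                         = p
reweight b (x ∷ w) (B , B⊆R , B≠∅ , _ , p) = B , B⊆R , B≠∅ , refl , reweight b w p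

blockSums-reweight : ∀ {t} {a : Vec ℕ t} (b : Vec ℕ t) {R} w (p : OrderedPartition a R w) →
                     blockSums a (blockSums b w p) (reweight b w p) ≡ w
blockSums-reweight b []      p                   = refl
blockSums-reweight b (x ∷ w) (B , _ , _ , ΣB≡x , p) = cong₂ _∷_ ΣB≡x (blockSums-reweight b w p)

blockSums-length : ∀ {t} {a : Vec ℕ t} (b : Vec ℕ t) {R} w (p : OrderedPartition a R w) →
                   length (blockSums b w p) ≡ length w
blockSums-length b []      p                   = refl
blockSums-length b (x ∷ w) (B , _ , _ , _ , p) = cong suc (blockSums-length b w p)

OrderedPartition-pos : ∀ {t} {a : Vec ℕ t} → AllPos a → ∀ {R} w → OrderedPartition a R w → All (1 ≤_) w
OrderedPartition-pos a⁺ []      p                        = []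
OrderedPartition-pos {a = a} a⁺ (x ∷ w) (B , _ , B≠∅ , ΣB≡x , p) =
  subst (1 ≤_) ΣB≡x (sumSub-pos a a⁺ B≠∅) ∷ OrderedPartition-pos a⁺ w p

OrderedPartition-sum : ∀ {t} (a : Vec ℕ t) R w → OrderedPartition a R w → sumℕ w ≡ sumSub a R
OrderedPartition-sum a R []      R-empty                  = sym (sumSub-Empty a R-empty)
OrderedPartition-sum a R (x ∷ w) (B , B⊆R , _ , ΣB≡x , p) =
  trans (cong₂ ℕ._+_ (sym ΣB≡x) (OrderedPartition-sum a (R ─ B) w p)) (sym (sumSub-⊆ a B R B⊆R))

∪-⊆ : ∀ {t} {B C R : Subset t} → B ⊆ R → C ⊆ R ─ B → B ∪ C ⊆ R
∪-⊆ {B = B} {C} {R} B⊆R C⊆R─B x∈B∪C with x∈p∪q⁻ B C x∈B∪C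
... | inj₁ x∈B = B⊆R x∈B
... | inj₂ x∈C = p─q⊆p R B (C⊆R─B x∈C)

⊆─⇒disjoint : ∀ {t} {B C R : Subset t} → C ⊆ R ─ B → Disjoint B C
⊆─⇒disjoint {B = B} {C} {R} C⊆R─B (x , x∈B∩C) =
  x∈p─q⇒x∉q R B (C⊆R─B (proj₂ (x∈p∩q⁻ B C x∈B∩C))) (proj₁ (x∈p∩q⁻ B C x∈B∩C))

OrderedPartition-merge : ∀ {t} {a : Vec ℕ t} j {R} u → suc j < length u →
                         OrderedPartition a R u → OrderedPartition a R (merge j u)
OrderedPartition-merge {a = a} zero {R} (x ∷ y ∷ u) _ (B , B⊆R , B≠∅ , ΣB≡x , C , C⊆R─B , _ , ΣC≡y , p) =
  B ∪ C , ∪-⊆ B⊆R C⊆R─B , (proj₁ B≠∅ , p⊆p∪q C (proj₂ B≠∅)) ,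
  trans (sumSub-∪ a B C (⊆─⇒disjoint C⊆R─B)) (cong₂ ℕ._+_ ΣB≡x ΣC≡y) ,
  subst (λ S → OrderedPartition a S u) (p─q─r≡p─q∪r R B C) p
OrderedPartition-merge (suc j) (x ∷ y ∷ z ∷ u) (s≤s j<) (B , B⊆R , B≠∅ , ΣB≡x , p) =
  B , B⊆R , B≠∅ , ΣB≡x , OrderedPartition-merge j (y ∷ z ∷ u) j< p
OrderedPartition-merge zero    (x ∷ [])     (s≤s ())       _
OrderedPartition-merge (suc j) (x ∷ y ∷ []) (s≤s (s≤s ())) _

blockSums-merge : ∀ {t} {a : Vec ℕ t} (b : Vec ℕ t) j {R} u (j< : suc j < length u) (p : OrderedPartition a R u) →
                  blockSums b (merge j u) (OrderedPartition-merge j u j< p) ≡ merge j (blockSums b u p)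
blockSums-merge {a = a} b zero {R} (x ∷ y ∷ u) _ (B , _ , _ , _ , C , C⊆R─B , _ , _ , p) =
  cong₂ _∷_ (sumSub-∪ b B C (⊆─⇒disjoint C⊆R─B)) (blockSums-subst (p─q─r≡p─q∪r R B C) p)
  where
  blockSums-subst : ∀ {S S′} (S≡S′ : S ≡ S′) (q : OrderedPartition a S u) →
                    blockSums b u (subst (λ S → OrderedPartition a S u) S≡S′ q) ≡ blockSums b u q
  blockSums-subst refl q = refl
blockSums-merge b (suc j) (x ∷ y ∷ z ∷ u) (s≤s j<) (B , _ , _ , _ , p) =
  cong (sumSub b B ∷_) (blockSums-merge b j (y ∷ z ∷ u) j< p)
blockSums-merge b zero    (x ∷ [])     (s≤s ())       _
blockSums-merge b (suc j) (x ∷ y ∷ []) (s≤s (s≤s ())) _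

elems : ∀ {t} → Vec ℕ t → Subset t → List ℕ
elems []      []          = []
elems (x ∷ a) (true ∷ R)  = x ∷ elems a R
elems (x ∷ a) (false ∷ R) = elems a R

elems-full : ∀ {t} (a : Vec ℕ t) → elems a full ≡ toList a
elems-full []      = refl
elems-full (x ∷ a) = cong (x ∷_) (elems-full a)

elems-sum : ∀ {t} (a : Vec ℕ t) B → sumℕ (elems a B) ≡ sumSub a B
elems-sum []      []          = refl
elems-sum (x ∷ a) (true ∷ B)  = cong (x ℕ.+_) (elems-sum a B)
elems-sum (x ∷ a) (false ∷ B) = elems-sum a B

elems-Empty : ∀ {t} (a : Vec ℕ t) {R} → Empty R → elems a R ≡ []
elems-Empty a R-empty rewrite Empty-unique R-empty = elems-∅ a
  where
  elems-∅ : ∀ {t} (a : Vec ℕ t) → elems a ∅ ≡ []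
  elems-∅ []      = refl
  elems-∅ (x ∷ a) = elems-∅ a

elems≡[]⇒Empty : ∀ {t} (a : Vec ℕ t) R → elems a R ≡ [] → Empty R
elems≡[]⇒Empty (x ∷ a) (true ∷ R)  ()
elems≡[]⇒Empty (x ∷ a) (false ∷ R) eq (suc i , there i∈R) = elems≡[]⇒Empty a R eq (i , i∈R)

elems-⊆ : ∀ {t} (a : Vec ℕ t) B R → B ⊆ R → elems a R ↭ elems a B ++ elems a (R ─ B)
elems-⊆ []      []          []          _   = ↭.refl
elems-⊆ (x ∷ a) (true ∷ B)  (true ∷ R)  B⊆R = ↭.prep x (elems-⊆ a B R (drop-∷-⊆ B⊆R))
elems-⊆ (x ∷ a) (true ∷ B)  (false ∷ R) B⊆R with B⊆R here
... | ()
elems-⊆ (x ∷ a) (false ∷ B) (true ∷ R)  B⊆R =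
  ↭.trans (↭.prep x (elems-⊆ a B R (drop-∷-⊆ B⊆R))) (↭.↭-sym (↭ₚ.shift x (elems a B) (elems a (R ─ B))))
elems-⊆ (x ∷ a) (false ∷ B) (false ∷ R) B⊆R = elems-⊆ a B R (drop-∷-⊆ B⊆R)

OrderedPartition⇒coarsening : ∀ {t} (a : Vec ℕ t) R w → OrderedPartition a R w → ∃[ β ] β ↭ elems a R × w ≤c β
OrderedPartition⇒coarsening a R []      R-empty = [] , subst ([] ↭_) (sym (elems-Empty a R-empty)) ↭.refl , nil
OrderedPartition⇒coarsening a R (x ∷ w) (B , B⊆R , B≠∅ , ΣB≡x , p)
  with OrderedPartition⇒coarsening a (R ─ B) w p
... | β , β↭ , w≤β =
  elems a B ++ β ,
  ↭.trans (↭ₚ.++⁺ˡ (elems a B) β↭) (↭.↭-sym (elems-⊆ a B R B⊆R)) ,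
  cons (elems a B) β (λ eq → elems≡[]⇒Empty a B eq B≠∅) (trans (sym ΣB≡x) (sym (elems-sum a B))) w≤β

Realisable⇒InD : ∀ {t} (a : Vec ℕ t) w → Realisable a w → InD (toList a) w
Realisable⇒InD a w p with OrderedPartition⇒coarsening a full w p
... | β , β↭ , w≤β = β , subst (β ↭_) (elems-full a) β↭ , w≤β

pickPart : ∀ {t} (a : Vec ℕ t) R y → y ∈ₗ elems a R →
           ∃[ S ] S ⊆ R × Nonempty S × sumSub a S ≡ y × elems a R ↭ y ∷ elems a (R ─ S)
pickPart []      []         y ()
pickPart (x ∷ a) (true ∷ R) y (Any.here refl) =
  true ∷ ∅ , ⁅0⁆⊆ , (zero , here) , sumSub-⁅0⁆ x a ,
  subst (λ S → x ∷ elems a R ↭ x ∷ elems a S) (sym (p─⊥≡p R)) ↭.refl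
pickPart (x ∷ a) (true ∷ R) y (Any.there y∈) with pickPart a R y y∈
... | S , S⊆R , S≠∅ , ΣS≡y , R↭ =
  false ∷ S , out⊆ S⊆R , Nonempty-∷ S≠∅ , ΣS≡y , ↭.trans (↭.prep x R↭) (↭.swap x y ↭.refl)
pickPart (x ∷ a) (false ∷ R) y y∈ with pickPart a R y y∈
... | S , S⊆R , S≠∅ , ΣS≡y , R↭ = false ∷ S , out⊆ S⊆R , Nonempty-∷ S≠∅ , ΣS≡y , R↭

pickBlock : ∀ {t} (a : Vec ℕ t) xs ys R → xs ++ ys ↭ elems a R →
            ∃[ B ] B ⊆ R × sumSub a B ≡ sumℕ xs × (xs ≢ [] → Nonempty B) × ys ↭ elems a (R ─ B)
pickBlock a []       ys R ys↭ =
  ∅ , ⊥⊆ , sumSub-∅ a , (λ []≢[] → ⊥-elim ([]≢[] refl)) , subst (λ S → ys ↭ elems a S) (sym (p─⊥≡p R)) ys↭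
pickBlock a (y ∷ xs) ys R ↭R with pickPart a R y (↭ₚ.∈-resp-↭ ↭R (Any.here refl))
... | S , S⊆R , S≠∅ , ΣS≡y , R↭ with pickBlock a xs ys (R ─ S) (↭ₚ.drop-∷ (↭.trans ↭R R↭))
...   | B , B⊆R─S , ΣB≡ , _ , ys↭ =
  S ∪ B , ∪-⊆ S⊆R B⊆R─S ,
  trans (sumSub-∪ a S B (⊆─⇒disjoint B⊆R─S)) (cong₂ ℕ._+_ ΣS≡y ΣB≡) ,
  (λ _ → proj₁ S≠∅ , p⊆p∪q B (proj₂ S≠∅)) ,
  subst (λ S → ys ↭ elems a S) (p─q─r≡p─q∪r R S B) ys↭

coarsening⇒OrderedPartition : ∀ {t} (a : Vec ℕ t) R w β → β ↭ elems a R → w ≤c β → OrderedPartition a R w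
coarsening⇒OrderedPartition a R []      []             β↭ nil = elems≡[]⇒Empty a R (↭ₚ.↭-empty-inv (↭.↭-sym β↭))
coarsening⇒OrderedPartition a R (x ∷ w) .(bs₁ ++ bs) β↭ (cons bs₁ bs bs₁≢[] x≡ w≤bs)
  with pickBlock a bs₁ bs R β↭
... | B , B⊆R , ΣB≡ , B≠∅ , bs↭ =
  B , B⊆R , B≠∅ bs₁≢[] , trans ΣB≡ (sym x≡) , coarsening⇒OrderedPartition a (R ─ B) w bs bs↭ w≤bs

InD⇒Realisable : ∀ {t} (a : Vec ℕ t) w → InD (toList a) w → Realisable a w
InD⇒Realisable a w (β , β↭ , w≤β) = coarsening⇒OrderedPartition a full w β (subst (β ↭_) (sym (elems-full a)) β↭) w≤β

─-Empty : ∀ {t} {R B : Subset t} → R ⊆ B → Empty (R ─ B)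
─-Empty {R = R} {B} R⊆B (x , x∈R─B) = x∈p─q⇒x∉q R B x∈R─B (R⊆B (p─q⊆p R B x∈R─B))

∪─≡ : ∀ {t} (B₁ B : Subset t) → B₁ ⊆ B → B₁ ∪ (B ─ B₁) ≡ B
∪─≡ []          []          _     = refl
∪─≡ (true ∷ B₁) (true ∷ B)  B₁⊆B = cong (true ∷_) (∪─≡ B₁ B (drop-∷-⊆ B₁⊆B))
∪─≡ (true ∷ B₁) (false ∷ B) B₁⊆B with B₁⊆B here
... | ()
∪─≡ (false ∷ B₁) (b ∷ B)    B₁⊆B = cong (b ∷_) (∪─≡ B₁ B (drop-∷-⊆ B₁⊆B))

twoBlocks : ∀ {t} (a : Vec ℕ t) F → Nonempty F → Nonempty (∁ F) → Realisable a (sumSub a F ∷ sumSub a (∁ F) ∷ [])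
twoBlocks a F F≠∅ ∁F≠∅ =
  F , ⊆⊤ , F≠∅ , refl ,
  ∁ F , (λ x∈∁F → x∈p∧x∉q⇒x∈p─q ∈⊤ (x∈∁p⇒x∉p x∈∁F)) , ∁F≠∅ , refl ,
  ─-Empty (λ x∈full─F → x∉p⇒x∈∁p (x∈p─q⇒x∉q full F x∈full─F))

OrderedPartition-swap : ∀ {t} {a : Vec ℕ t} {R x y w} → OrderedPartition a R (x ∷ y ∷ w) → OrderedPartition a R (y ∷ x ∷ w)
OrderedPartition-swap {a = a} {R} {w = w} (B , B⊆R , B≠∅ , ΣB≡x , C , C⊆R─B , C≠∅ , ΣC≡y , p) =
  C , p─q⊆p R B ∘ C⊆R─B , C≠∅ , ΣC≡y ,
  B , (λ x∈B → x∈p∧x∉q⇒x∈p─q (B⊆R x∈B) (λ x∈C → x∈p─q⇒x∉q R B (C⊆R─B x∈C) x∈B)) , B≠∅ , ΣB≡x ,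
  subst (λ S → OrderedPartition a S w) (p─q─r≡p─r─q R B C) p

OrderedPartition-splitFront : ∀ {t} {a : Vec ℕ t} {R x w} (p : OrderedPartition a R (x ∷ w)) B₁ →
                              B₁ ⊆ proj₁ p → Nonempty B₁ → Nonempty (proj₁ p ─ B₁) →
                              OrderedPartition a R (sumSub a B₁ ∷ (x ∸ sumSub a B₁) ∷ w)
OrderedPartition-splitFront {a = a} {R} {w = w} (B , B⊆R , _ , ΣB≡x , p) B₁ B₁⊆B B₁≠∅ B─B₁≠∅ =
  B₁ , (B⊆R ∘ B₁⊆B) , B₁≠∅ , refl ,
  B ─ B₁ , (λ x∈ → x∈p∧x∉q⇒x∈p─q (B⊆R (p─q⊆p B B₁ x∈)) (x∈p─q⇒x∉q B B₁ x∈)) , B─B₁≠∅ ,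
  sym (trans (cong (_∸ sumSub a B₁) (trans (sym ΣB≡x) (sumSub-⊆ a B₁ B B₁⊆B))) (ℕₚ.m+n∸m≡n (sumSub a B₁) _)) ,
  subst (λ S → OrderedPartition a S w)
        (sym (trans (p─q─r≡p─q∪r R B₁ (B ─ B₁)) (cong (R ─_) (∪─≡ B₁ B B₁⊆B)))) p

oneBlock : ∀ {t} (a : Vec ℕ t) {R} → Nonempty R → OrderedPartition a R (sumSub a R ∷ [])
oneBlock a R≠∅ = _ , ⊆-refl , R≠∅ , refl , ─-Empty ⊆-refl

OrderedPartition-skip : ∀ {t} {a : Vec ℕ t} x {R} w → OrderedPartition a R w → OrderedPartition (x ∷ a) (false ∷ R) w
OrderedPartition-skip x []      R-empty (suc i , there i∈R)      = R-empty (i , i∈R)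
OrderedPartition-skip x (y ∷ w) (B , B⊆R , B≠∅ , ΣB≡y , p) =
  false ∷ B , out⊆ B⊆R , Nonempty-∷ B≠∅ , ΣB≡y , OrderedPartition-skip x w p

OrderedPartition-here : ∀ {t} {a : Vec ℕ t} x {R} w → OrderedPartition a R w → OrderedPartition (x ∷ a) (true ∷ R) (x ∷ w)
OrderedPartition-here {a = a} x {R} w p =
  true ∷ ∅ , ⁅0⁆⊆ , (zero , here) , sumSub-⁅0⁆ x a ,
  subst (λ S → OrderedPartition (x ∷ a) (false ∷ S) w) (sym (p─⊥≡p R)) (OrderedPartition-skip x w p)

-- Transferring compositions between two weights

-- the b-sums of the blocks of some fixed a-partition realising w ([] if there is none);
-- below, a case split on orderedPartition? a full w next to a hypothesis about transfer a b w
-- goes through an auxiliary function taking the decision, as `with` would rewrite that hypothesis too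
transfer : ∀ {t} (a b : Vec ℕ t) → List ℕ → List ℕ
transfer a b w with orderedPartition? a full w
... | yes p = blockSums b w p
... | no  _ = []

transfer-realisable : ∀ {t} (a b : Vec ℕ t) w → Realisable a w → ∃[ p ] transfer a b w ≡ blockSums b w p
transfer-realisable a b w p₀ with orderedPartition? a full w
... | yes p  = p , refl
... | no  ¬p = ⊥-elim (¬p p₀)

transfer-unrealisable : ∀ {t} (a b : Vec ℕ t) w → ¬ Realisable a w → transfer a b w ≡ []
transfer-unrealisable a b w ¬p₀ with orderedPartition? a full w
... | yes p  = ⊥-elim (¬p₀ p)
... | no  ¬p = refl

transfer-length : ∀ {t} (a b : Vec ℕ t) w → Realisable a w → length (transfer a b w) ≡ length w
transfer-length a b w p₀ with transfer-realisable a b w p₀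
... | p , eq = trans (cong length eq) (blockSums-length b w p)

¬Realisable-[] : ∀ {t} (a : Vec ℕ t) → 1 ≤ t → ¬ Realisable a []
¬Realisable-[] a (s≤s _) full-empty = full-empty (zero , here)

transfer-reflects : ∀ {t} (a b : Vec ℕ t) → 1 ≤ t → ∀ w → Realisable b (transfer a b w) → Realisable a w
transfer-reflects a b 1≤t w pb with orderedPartition? a full w
... | yes p  = p
... | no  ¬p = ⊥-elim (¬Realisable-[] b 1≤t pb)

split-realisable : ∀ {t} (a : Vec ℕ t) j w x → j < length w → x ≤ part w j →
                   Realisable a (split j w x) → Realisable a w
split-realisable a j w x j< x≤ p =
  subst (Realisable a) (merge-split j w x j< x≤)
        (OrderedPartition-merge j (split j w x) (subst (suc j <_) (sym (split-length j w x j<)) (s≤s j<)) p)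

WellDefinedOff : ∀ {t} → (List ℕ → Set) → Vec ℕ t → Vec ℕ t → Set
WellDefinedOff E a b = ∀ u (p q : Realisable a u) → ¬ E u → blockSums b u p ≡ blockSums b u q

transfer-transfer : ∀ {t} (a b : Vec ℕ t) {E} → WellDefinedOff E b a →
                    ∀ w → Realisable a w → ¬ E (transfer a b w) → transfer b a (transfer a b w) ≡ w
transfer-transfer a b {E} wd w p₀ ¬E with transfer-realisable a b w p₀
... | p , eq with transfer-realisable b a (blockSums b w p) (reweight b w p)
...   | q , eq′ =
  trans (cong (transfer b a) eq)
        (trans eq′ (trans (wd (blockSums b w p) q (reweight b w p) (λ e → ¬E (subst E (sym eq) e)))
                          (blockSums-reweight b w p)))

wellDefined-≡ : ∀ {t} {a b : Vec ℕ t} {E} → WellDefinedOff E a b →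
                ∀ {u u′} → u ≡ u′ → (p : Realisable a u) (p′ : Realisable a u′) → ¬ E u →
                blockSums b u p ≡ blockSums b u′ p′
wellDefined-≡ wd {u} refl p p′ ¬E = wd u p p′ ¬E

All-part : ∀ {P : ℕ → Set} {u} j → All P u → j < length u → P (part u j)
All-part zero    (Pu₀ ∷ _)   _        = Pu₀
All-part (suc j) (_ ∷ Pu)    (s≤s j<) = All-part j Pu j<

merge≡⇒split : ∀ j u W → suc j < length u → 1 ≤ part u j → 1 ≤ part u (suc j) → merge j u ≡ W →
               split j W (suc (part u j ∸ 1)) ≡ u × part u j ∸ 1 < part W j ∸ 1
merge≡⇒split j u .(merge j u) j+1< 1≤uⱼ 1≤uⱼ₊₁ refl =
  trans (cong (split j (merge j u)) (ℕₚ.m+[n∸m]≡n 1≤uⱼ)) (split-merge j u j+1<) ,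
  subst (λ W → part u j ∸ 1 < W ∸ 1) (sym (part-merge j u j+1<)) (∸1-< (part u j) (part u (suc j)) 1≤uⱼ 1≤uⱼ₊₁)
  where
  ∸1-< : ∀ e f → 1 ≤ e → 1 ≤ f → e ∸ 1 < (e ℕ.+ f) ∸ 1
  ∸1-< (suc e) (suc f) _ _ = ℕₚ.m<m+n e (s≤s z≤n)

transfer-split : ∀ {t} (a b : Vec ℕ t) → AllPos b → ∀ {E} → WellDefinedOff E a b →
                 ∀ w (p : Realisable a w) → ¬ E w → ∀ j x → j < length w → x < part w j ∸ 1 →
                 Realisable a (split j w (suc x)) →
                 let y = part (transfer a b (split j w (suc x))) j ∸ 1 in
                 split j (blockSums b w p) (suc y) ≡ transfer a b (split j w (suc x)) ×
                 y < part (blockSums b w p) j ∸ 1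
transfer-split a b b⁺ {E} wd w p ¬E j x j< x< pᵥ with transfer-realisable a b (split j w (suc x)) pᵥ
... | q , Φv≡ = subst (λ u → split j W̃ (suc (part u j ∸ 1)) ≡ u × part u j ∸ 1 < part W̃ j ∸ 1) (sym Φv≡) refined
  where
  v  = split j w (suc x)
  W̃ = blockSums b w p
  u  = blockSums b v q
  j+1<v : suc j < length v
  j+1<v = subst (suc j <_) (sym (split-length j w (suc x) j<)) (s≤s j<)
  j+1<u : suc j < length u
  j+1<u = subst (suc j <_) (sym (blockSums-length b v q)) j+1<v
  merge-v : merge j v ≡ w
  merge-v = merge-split j w (suc x) j< (ℕₚ.≤-trans x< (ℕₚ.m∸n≤m (part w j) 1))
  merge-u : merge j u ≡ W̃
  merge-u = trans (sym (blockSums-merge b j v j+1<v q))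
                  (wellDefined-≡ wd merge-v (OrderedPartition-merge j v j+1<v q) p (λ e → ¬E (subst E merge-v e)))
  u⁺ : All (1 ≤_) u
  u⁺ = OrderedPartition-pos b⁺ u (reweight b v q)
  refined : split j W̃ (suc (part u j ∸ 1)) ≡ u × part u j ∸ 1 < part W̃ j ∸ 1
  refined = merge≡⇒split j u W̃ j+1<u (All-part j u⁺ (ℕₚ.<-trans (ℕₚ.n<1+n j) j+1<u)) (All-part (suc j) u⁺ j+1<u) merge-u

long⇒¬short : ∀ {E : List ℕ → Set} → (∀ u → E u → length u ≡ 2) → ∀ u → 3 ≤ length u → ¬ E u
long⇒¬short E-short u 3≤u Eu with subst (3 ≤_) (E-short u Eu) 3≤u
... | s≤s (s≤s ())

module Commutation {t} (a b : Vec ℕ t) (a⁺ : AllPos a) (b⁺ : AllPos b) (1≤t : 1 ≤ t)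
  (Eᵃ Eᵇ : List ℕ → Set) (Eᵃ-short : ∀ u → Eᵃ u → length u ≡ 2) (Eᵇ-short : ∀ u → Eᵇ u → length u ≡ 2)
  (wdᵃᵇ : WellDefinedOff Eᵃ a b) (wdᵇᵃ : WellDefinedOff Eᵇ b a) where

  Φ Ψ : List ℕ → List ℕ
  Φ = transfer a b
  Ψ = transfer b a

  -- Φ maps the refinements of w at position j bijectively onto those of Φ w
  refinements-transfer :
    (c : List ℕ → ℤ) → (∀ u → c u ≢ 0ℤ → Realisable b u) →
    ∀ w (p : Realisable a w) → ¬ Eᵃ w → ¬ Eᵇ (blockSums b w p) → 2 ≤ length w → ∀ j → j < length w →
    Σ< (part w j ∸ 1) (λ x → c (Φ (split j w (suc x)))) ≡
    Σ< (part (blockSums b w p) j ∸ 1) (λ y → c (split j (blockSums b w p) (suc y)))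
  refinements-transfer c c-supp w p ¬Eᵃw ¬Eᵇw̃ 2≤w j j< =
    Σ<-reindex (part w j ∸ 1) (part w̃ j ∸ 1) _ _ h k f→g g→f
    where
    w̃ : List ℕ
    w̃ = blockSums b w p
    j<w̃ : j < length w̃
    j<w̃ = subst (j <_) (sym (blockSums-length b w p)) j<
    h k : ℕ → ℕ
    h x = part (Φ (split j w (suc x))) j ∸ 1
    k y = part (Ψ (split j w̃ (suc y))) j ∸ 1
    3≤split : ∀ u i z → i < length u → length u ≡ length w → 3 ≤ length (split i u z)
    3≤split u i z i<u |u|≡|w| = subst (3 ≤_) (sym (trans (split-length i u z i<u) (cong suc |u|≡|w|))) (s≤s 2≤w)
    f→g : ∀ x → x < part w j ∸ 1 → c (Φ (split j w (suc x))) ≢ 0ℤ →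
          h x < part w̃ j ∸ 1 × k (h x) ≡ x × c (split j w̃ (suc (h x))) ≡ c (Φ (split j w (suc x)))
    f→g x x< fx≢0 = h< , k∘h , cong c split≡
      where
      v : List ℕ
      v = split j w (suc x)
      pᵥ : Realisable a v
      pᵥ = transfer-reflects a b 1≤t v (c-supp _ fx≢0)
      split≡ : split j w̃ (suc (h x)) ≡ Φ v
      split≡ = proj₁ (transfer-split a b b⁺ wdᵃᵇ w p ¬Eᵃw j x j< x< pᵥ)
      h< : h x < part w̃ j ∸ 1
      h< = proj₂ (transfer-split a b b⁺ wdᵃᵇ w p ¬Eᵃw j x j< x< pᵥ)
      3≤Φv : 3 ≤ length (Φ v)
      3≤Φv = subst (3 ≤_) (sym (transfer-length a b v pᵥ)) (3≤split w j (suc x) j< refl)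
      k∘h : k (h x) ≡ x
      k∘h = trans (cong (λ u → part (Ψ u) j ∸ 1) split≡)
                  (trans (cong (λ u → part u j ∸ 1) (transfer-transfer a b wdᵇᵃ v pᵥ (long⇒¬short Eᵇ-short _ 3≤Φv)))
                         (cong (_∸ 1) (part-split j w (suc x) j<)))
    g→f : ∀ y → y < part w̃ j ∸ 1 → c (split j w̃ (suc y)) ≢ 0ℤ →
          k y < part w j ∸ 1 × h (k y) ≡ y × c (Φ (split j w (suc (k y)))) ≡ c (split j w̃ (suc y))
    g→f y y< gy≢0 = k< , h∘k , cong c ΦΨṽ
      where
      ṽ : List ℕ
      ṽ = split j w̃ (suc y)
      pṽ : Realisable b ṽ
      pṽ = c-supp ṽ gy≢0
      k< : k y < part w j ∸ 1
      k< = subst (λ u → k y < part u j ∸ 1) (blockSums-reweight b w p)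
                 (proj₂ (transfer-split b a a⁺ wdᵇᵃ w̃ (reweight b w p) ¬Eᵇw̃ j y j<w̃ y< pṽ))
      split≡ : split j w (suc (k y)) ≡ Ψ ṽ
      split≡ = trans (cong (λ u → split j u (suc (k y))) (sym (blockSums-reweight b w p)))
                     (proj₁ (transfer-split b a a⁺ wdᵇᵃ w̃ (reweight b w p) ¬Eᵇw̃ j y j<w̃ y< pṽ))
      3≤Ψṽ : 3 ≤ length (Ψ ṽ)
      3≤Ψṽ = subst (3 ≤_) (sym (transfer-length b a ṽ pṽ)) (3≤split w̃ j (suc y) j<w̃ (blockSums-length b w p))
      ΦΨṽ : Φ (split j w (suc (k y))) ≡ ṽ
      ΦΨṽ = trans (cong Φ split≡) (transfer-transfer b a wdᵃᵇ ṽ pṽ (long⇒¬short Eᵃ-short _ 3≤Ψṽ))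
      h∘k : h (k y) ≡ y
      h∘k = trans (cong (λ u → part u j ∸ 1) ΦΨṽ) (cong (_∸ 1) (part-split j w̃ (suc y) j<w̃))

  ∂-transfer : (c : List ℕ → ℤ) → (∀ u → c u ≢ 0ℤ → Realisable b u) →
               ∀ w → 2 ≤ length w → ¬ Eᵃ w → ¬ Eᵇ (Φ w) → ∂ (c ∘ Φ) w ≡ ∂ c (Φ w)
  ∂-transfer c c-supp w 2≤w ¬Eᵃw ¬EᵇΦw with orderedPartition? a full w
  ... | yes p = begin
      ∂ (c ∘ Φ) w
    ≡⟨ ∂-positional (c ∘ Φ) w ⟩
      Σ< (length w) (λ j → signed j (Σ< (part w j ∸ 1) (λ x → c (Φ (split j w (suc x))))))
    ≡⟨ Σ<-congᵇ (length w) (λ j j< → cong (signed j) (refinements-transfer c c-supp w p ¬Eᵃw ¬EᵇΦw 2≤w j j<)) ⟩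
      Σ< (length w) (λ j → signed j (Σ< (part w̃ j ∸ 1) (λ y → c (split j w̃ (suc y)))))
    ≡⟨ cong (λ n → Σ< n (λ j → signed j (Σ< (part w̃ j ∸ 1) (λ y → c (split j w̃ (suc y))))))
            (sym (blockSums-length b w p)) ⟩
      Σ< (length w̃) (λ j → signed j (Σ< (part w̃ j ∸ 1) (λ y → c (split j w̃ (suc y)))))
    ≡⟨ sym (∂-positional c w̃) ⟩
      ∂ c w̃
    ∎
    where
    open ≡-Reasoning
    w̃ : List ℕ
    w̃ = blockSums b w p
  ... | no ¬p = trans (∂-positional (c ∘ Φ) w) (Σ<-zeroᵇ (length w) λ j j< →
                  trans (cong (signed j) (Σ<-zeroᵇ (part w j ∸ 1) (λ x x< → refinement-vanishes j x j< x<))) (signed-zero j))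
    where
    refinement-vanishes : ∀ j x → j < length w → x < part w j ∸ 1 → c (Φ (split j w (suc x))) ≡ 0ℤ
    refinement-vanishes j x j< x< with c (Φ (split j w (suc x))) ℤ.≟ 0ℤ
    ... | yes ≡0 = ≡0
    ... | no  ≢0 = ⊥-elim (¬p (split-realisable a j w (suc x) j< (ℕₚ.≤-trans x< (ℕₚ.m∸n≤m (part w j) 1))
                                  (transfer-reflects a b 1≤t _ (c-supp _ ≢0))))

-- The added resonance

module SwapCount (A B m : ℕ) where

  data Pointwise : List ℕ → List ℕ → List ℕ → Set where
    []    : Pointwise [] [] []
    agree : ∀ {x y u₁ u₂ ũ} → Pointwise u₁ u₂ ũ → Pointwise (x ∷ u₁) (x ∷ u₂) (y ∷ ũ)
    ab    : ∀ {u₁ u₂ ũ} → Pointwise u₁ u₂ ũ → Pointwise (A ∷ u₁) (B ∷ u₂) (m ∷ ũ)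
    ba    : ∀ {u₁ u₂ ũ} → Pointwise u₁ u₂ ũ → Pointwise (B ∷ u₁) (A ∷ u₂) (m ∷ ũ)

  #ab #ba #agree agreed : ∀ {u₁ u₂ ũ} → Pointwise u₁ u₂ ũ → ℕ
  #ab []        = 0
  #ab (agree π) = #ab π
  #ab (ab π)    = suc (#ab π)
  #ab (ba π)    = #ab π
  #ba []        = 0
  #ba (agree π) = #ba π
  #ba (ab π)    = #ba π
  #ba (ba π)    = suc (#ba π)
  #agree []        = 0
  #agree (agree π) = suc (#agree π)
  #agree (ab π)    = #agree π
  #agree (ba π)    = #agree π
  agreed [] = 0
  agreed (agree {x} π) = x ℕ.+ agreed π
  agreed (ab π)        = agreed π
  agreed (ba π)        = agreed π

  sum₁ : ∀ {u₁ u₂ ũ} (π : Pointwise u₁ u₂ ũ) → sumℕ u₁ ≡ agreed π ℕ.+ (#ab π ℕ.* A ℕ.+ #ba π ℕ.* B)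
  sum₁ []            = refl
  sum₁ (agree {x} π) = trans (cong (x ℕ.+_) (sum₁ π)) (sym (ℕₚ.+-assoc x (agreed π) _))
  sum₁ (ab π)        = trans (cong (A ℕ.+_) (sum₁ π)) (shift (agreed π) (#ab π) (#ba π) A B)
    where
    shift : ∀ E x y A B → A ℕ.+ (E ℕ.+ (x ℕ.* A ℕ.+ y ℕ.* B)) ≡ E ℕ.+ ((1 ℕ.+ x) ℕ.* A ℕ.+ y ℕ.* B)
    shift = solveℕ-∀
  sum₁ (ba π)        = trans (cong (B ℕ.+_) (sum₁ π)) (shift (agreed π) (#ab π) (#ba π) A B)
    where
    shift : ∀ E x y A B → B ℕ.+ (E ℕ.+ (x ℕ.* A ℕ.+ y ℕ.* B)) ≡ E ℕ.+ (x ℕ.* A ℕ.+ (1 ℕ.+ y) ℕ.* B)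
    shift = solveℕ-∀

  sum₂ : ∀ {u₁ u₂ ũ} (π : Pointwise u₁ u₂ ũ) → sumℕ u₂ ≡ agreed π ℕ.+ (#ab π ℕ.* B ℕ.+ #ba π ℕ.* A)
  sum₂ []            = refl
  sum₂ (agree {x} π) = trans (cong (x ℕ.+_) (sum₂ π)) (sym (ℕₚ.+-assoc x (agreed π) _))
  sum₂ (ab π)        = trans (cong (B ℕ.+_) (sum₂ π)) (shift (agreed π) (#ab π) (#ba π) A B)
    where
    shift : ∀ E x y A B → B ℕ.+ (E ℕ.+ (x ℕ.* B ℕ.+ y ℕ.* A)) ≡ E ℕ.+ ((1 ℕ.+ x) ℕ.* B ℕ.+ y ℕ.* A)
    shift = solveℕ-∀
  sum₂ (ba π)        = trans (cong (A ℕ.+_) (sum₂ π)) (shift (agreed π) (#ab π) (#ba π) A B)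
    where
    shift : ∀ E x y A B → A ℕ.+ (E ℕ.+ (x ℕ.* B ℕ.+ y ℕ.* A)) ≡ E ℕ.+ (x ℕ.* B ℕ.+ (1 ℕ.+ y) ℕ.* A)
    shift = solveℕ-∀

  no-swaps : ∀ {u₁ u₂ ũ} (π : Pointwise u₁ u₂ ũ) → #ab π ≡ 0 → #ba π ≡ 0 → u₁ ≡ u₂
  no-swaps []            _      _      = refl
  no-swaps (agree {x} π) #ab≡0 #ba≡0 = cong (x ∷_) (no-swaps π #ab≡0 #ba≡0)
  no-swaps (ab π)        ()
  no-swaps (ba π)        _      ()

  #agree≤agreed : ∀ {u₁ u₂ ũ} (π : Pointwise u₁ u₂ ũ) → All (1 ≤_) u₁ → #agree π ≤ agreed π
  #agree≤agreed []        _          = z≤n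
  #agree≤agreed (agree π) (1≤x ∷ u⁺) = ℕₚ.+-mono-≤ 1≤x (#agree≤agreed π u⁺)
  #agree≤agreed (ab π)    (_ ∷ u⁺)   = #agree≤agreed π u⁺
  #agree≤agreed (ba π)    (_ ∷ u⁺)   = #agree≤agreed π u⁺

  no-agreements : ∀ {u₁ u₂ ũ} (π : Pointwise u₁ u₂ ũ) → #agree π ≡ 0 → All (_≡ m) ũ
  no-agreements []        _       = []
  no-agreements (ab π)    #agree≡0 = refl ∷ no-agreements π #agree≡0
  no-agreements (ba π)    #agree≡0 = refl ∷ no-agreements π #agree≡0

  length-ũ : ∀ {u₁ u₂ ũ} (π : Pointwise u₁ u₂ ũ) → length ũ ≡ #agree π ℕ.+ (#ab π ℕ.+ #ba π)
  length-ũ []        = refl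
  length-ũ (agree π) = cong suc (length-ũ π)
  length-ũ (ab π)    = trans (cong suc (length-ũ π)) (sym (ℕₚ.+-suc (#agree π) _))
  length-ũ (ba π)    = trans (cong suc (length-ũ π))
                             (sym (trans (cong (#agree π ℕ.+_) (ℕₚ.+-suc (#ab π) (#ba π))) (ℕₚ.+-suc (#agree π) _)))

  private
    balanced-≤ : ∀ {A B} x y → A ≢ B → x ≤ y → x ℕ.* A ℕ.+ y ℕ.* B ≡ x ℕ.* B ℕ.+ y ℕ.* A → x ≡ y
    balanced-≤ {A} {B} x y A≢B x≤y eq with ℕₚ.m≤n⇒∃[o]m+o≡n x≤y
    ... | d , refl =
      sym (trans (cong (x ℕ.+_) (d≡0 d (ℕₚ.+-cancelˡ-≡ (x ℕ.* A ℕ.+ x ℕ.* B) _ _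
                                                          (trans (l x d A B) (trans eq (r x d A B))))))
                 (ℕₚ.+-identityʳ x))
      where
      l : ∀ x d A B → (x ℕ.* A ℕ.+ x ℕ.* B) ℕ.+ d ℕ.* B ≡ x ℕ.* A ℕ.+ (x ℕ.+ d) ℕ.* B
      l = solveℕ-∀
      r : ∀ x d A B → x ℕ.* B ℕ.+ (x ℕ.+ d) ℕ.* A ≡ (x ℕ.* A ℕ.+ x ℕ.* B) ℕ.+ d ℕ.* A
      r = solveℕ-∀
      d≡0 : ∀ d → d ℕ.* B ≡ d ℕ.* A → d ≡ 0
      d≡0 zero    _   = refl
      d≡0 (suc d) eq′ = ⊥-elim (A≢B (sym (ℕₚ.*-cancelˡ-≡ B A (suc d) eq′)))

    balanced : ∀ x y → A ≢ B → x ℕ.* A ℕ.+ y ℕ.* B ≡ x ℕ.* B ℕ.+ y ℕ.* A → x ≡ y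
    balanced x y A≢B eq with ℕₚ.≤-total x y
    ... | inj₁ x≤y = balanced-≤ x y A≢B x≤y eq
    ... | inj₂ y≤x =
      sym (balanced-≤ y x A≢B y≤x (trans (ℕₚ.+-comm (y ℕ.* A) _) (trans (sym eq) (ℕₚ.+-comm (x ℕ.* A) _))))

  -- equal sums force as many (A,B) as (B,A) positions; a total of A + B then allows at most one of each
  pointwise-swap : A ≢ B → ∀ {u₁ u₂ ũ} → Pointwise u₁ u₂ ũ → All (1 ≤_) u₁ →
                   sumℕ u₁ ≡ A ℕ.+ B → sumℕ u₂ ≡ A ℕ.+ B → u₁ ≡ u₂ ⊎ ũ ≡ m ∷ m ∷ []
  pointwise-swap A≢B {u₁} {u₂} {ũ} π u₁⁺ Σu₁ Σu₂ = by-#ab (#ab π) refl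
    where
    #ab≡#ba : #ab π ≡ #ba π
    #ab≡#ba = balanced (#ab π) (#ba π) A≢B
                (ℕₚ.+-cancelˡ-≡ (agreed π) _ _ (trans (sym (sum₁ π)) (trans Σu₁ (trans (sym Σu₂) (sum₂ π)))))
    total : agreed π ℕ.+ #ab π ℕ.* (A ℕ.+ B) ≡ A ℕ.+ B
    total = trans (cong (agreed π ℕ.+_) (trans (ℕₚ.*-distribˡ-+ (#ab π) A B)
                                               (cong (λ n → #ab π ℕ.* A ℕ.+ n ℕ.* B) #ab≡#ba)))
                  (trans (sym (sum₁ π)) Σu₁)
    by-#ab : ∀ n → #ab π ≡ n → u₁ ≡ u₂ ⊎ ũ ≡ m ∷ m ∷ []
    by-#ab zero #ab≡0 = inj₁ (no-swaps π #ab≡0 (trans (sym #ab≡#ba) #ab≡0))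
    by-#ab (suc zero) #ab≡1 = inj₂ (length2 (trans (length-ũ π) length≡) (no-agreements π #agree≡0))
      where
      agreed≡0 : agreed π ≡ 0
      agreed≡0 = ℕₚ.+-cancelʳ-≡ (A ℕ.+ B) (agreed π) 0
                   (trans (cong (agreed π ℕ.+_) (sym (ℕₚ.*-identityˡ (A ℕ.+ B))))
                          (trans (cong (λ n → agreed π ℕ.+ n ℕ.* (A ℕ.+ B)) (sym #ab≡1)) total))
      #agree≡0 : #agree π ≡ 0
      #agree≡0 = ℕₚ.n≤0⇒n≡0 (subst (#agree π ≤_) agreed≡0 (#agree≤agreed π u₁⁺))
      length≡ : #agree π ℕ.+ (#ab π ℕ.+ #ba π) ≡ 2
      length≡ = trans (cong₂ (λ a n → a ℕ.+ (n ℕ.+ #ba π)) #agree≡0 #ab≡1) (cong (1 ℕ.+_) (trans (sym #ab≡#ba) #ab≡1))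
      length2 : ∀ {ũ : List ℕ} → length ũ ≡ 2 → All (_≡ m) ũ → ũ ≡ m ∷ m ∷ []
      length2 {_ ∷ _ ∷ []} _ (refl ∷ refl ∷ []) = refl
    by-#ab (suc (suc k)) #ab≡ = ⊥-elim (A≢B (trans A≡0 (sym B≡0)))
      where
      peel : ∀ E k S → E ℕ.+ (2 ℕ.+ k) ℕ.* S ≡ S ℕ.+ (S ℕ.+ (E ℕ.+ k ℕ.* S))
      peel = solveℕ-∀
      A+B≡0 : A ℕ.+ B ≡ 0
      A+B≡0 = ℕₚ.m+n≡0⇒m≡0 (A ℕ.+ B) (ℕₚ.+-cancelˡ-≡ (A ℕ.+ B) _ 0
                 (trans (sym (peel (agreed π) k (A ℕ.+ B)))
                        (trans (cong (λ n → agreed π ℕ.+ n ℕ.* (A ℕ.+ B)) (sym #ab≡))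
                               (trans total (sym (ℕₚ.+-identityʳ (A ℕ.+ B)))))))
      A≡0 : A ≡ 0
      A≡0 = ℕₚ.m+n≡0⇒m≡0 A A+B≡0
      B≡0 : B ≡ 0
      B≡0 = ℕₚ.m+n≡0⇒n≡0 A A+B≡0

─-disjoint : ∀ {t} (B C : Subset t) → Disjoint (B ─ C) (C ─ B)
─-disjoint B C (x , x∈) with x∈p∩q⁻ (B ─ C) (C ─ B) x∈
... | x∈B─C , x∈C─B = x∈p─q⇒x∉q C B x∈C─B (p─q⊆p B C x∈B─C)

sumSub-─⇒ : ∀ {t} (a : Vec ℕ t) B C → sumSub a B ≡ sumSub a C → sumSub a (B ─ C) ≡ sumSub a (C ─ B)
sumSub-─⇒ a B C ΣB≡ΣC = ℕₚ.+-cancelˡ-≡ (sumSub a (B ∩ C)) _ _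
  (trans (sym (sumSub-∩─ a B C))
         (trans ΣB≡ΣC (trans (sumSub-∩─ a C B) (cong (λ S → sumSub a S ℕ.+ sumSub a (C ─ B)) (∩-comm C B)))))

sumSub-─⇐ : ∀ {t} (a : Vec ℕ t) B C → sumSub a (B ─ C) ≡ sumSub a (C ─ B) → sumSub a B ≡ sumSub a C
sumSub-─⇐ a B C Σ≡ =
  trans (sumSub-∩─ a B C) (trans (cong₂ ℕ._+_ (cong (sumSub a) (∩-comm B C)) Σ≡) (sym (sumSub-∩─ a C B)))

-- B and C have equal a-sums iff their differences do, and those form a resonance unless one of them is empty
sumSub-transport : ∀ {t} (a b : Vec ℕ t) → AllPos a → ∀ B C → sumSub a B ≡ sumSub a C →
                   (IsResonance a (B ─ C) (C ─ B) → sumSub b (B ─ C) ≡ sumSub b (C ─ B)) →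
                   sumSub b B ≡ sumSub b C
sumSub-transport a b a⁺ B C ΣB≡ΣC transport = sumSub-─⇐ b B C (by-cases (nonempty? (B ─ C)) (nonempty? (C ─ B)))
  where
  Σ─≡ : sumSub a (B ─ C) ≡ sumSub a (C ─ B)
  Σ─≡ = sumSub-─⇒ a B C ΣB≡ΣC
  by-cases : Dec (Nonempty (B ─ C)) → Dec (Nonempty (C ─ B)) → sumSub b (B ─ C) ≡ sumSub b (C ─ B)
  by-cases (yes B─C≠∅) (yes C─B≠∅) = transport (B─C≠∅ , C─B≠∅ , ─-disjoint B C , Σ─≡)
  by-cases (no B─C=∅)  _           =
    trans (sumSub-Empty b B─C=∅) (sym (sumSub-Empty b (sumSub≡0⇒Empty a a⁺ (trans (sym Σ─≡) (sumSub-Empty a B─C=∅)))))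
  by-cases (yes _)     (no C─B=∅)  =
    trans (sumSub-Empty b (sumSub≡0⇒Empty a a⁺ (trans Σ─≡ (sumSub-Empty a C─B=∅)))) (sym (sumSub-Empty b C─B=∅))

─-complement : ∀ {t} (B C F : Subset t) → B ─ C ≡ F → C ─ B ≡ ∁ F → B ≡ F × C ≡ ∁ F
─-complement []          []          []          _    _    = refl , refl
─-complement (true ∷ B)  (false ∷ C) (true ∷ F)  eq₁  eq₂ with ─-complement B C F (cong Vec.tail eq₁) (cong Vec.tail eq₂)
... | B≡F , C≡∁F = cong (true ∷_) B≡F , cong (false ∷_) C≡∁F
─-complement (false ∷ B) (true ∷ C)  (false ∷ F) eq₁  eq₂ with ─-complement B C F (cong Vec.tail eq₁) (cong Vec.tail eq₂)
... | B≡F , C≡∁F = cong (false ∷_) B≡F , cong (true ∷_) C≡∁F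
─-complement (true ∷ B)  (true ∷ C)  (true ∷ F)  ()   _
─-complement (true ∷ B)  (true ∷ C)  (false ∷ F) _    ()
─-complement (true ∷ B)  (false ∷ C) (false ∷ F) ()   _
─-complement (false ∷ B) (true ∷ C)  (true ∷ F)  ()   _
─-complement (false ∷ B) (false ∷ C) (true ∷ F)  ()   _
─-complement (false ∷ B) (false ∷ C) (false ∷ F) _    ()

module NewResonance {t} (α α̃ : Vec ℕ t) (α⁺ : AllPos α) (α̃⁺ : AllPos α̃) (F : Subset t)
  (¬resonant : ¬ IsResonance α F (∁ F))
  (resonances : ∀ I J → IsResonance α̃ I J ⇔ (IsResonance α I J ⊎ SamePair I J F (∁ F))) where

  A B m : ℕ
  A = sumSub α F
  B = sumSub α (∁ F)
  m = sumSub α̃ F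

  resonant : IsResonance α̃ F (∁ F)
  resonant = Equivalence.from (resonances F (∁ F)) (inj₂ (inj₁ (refl , refl)))

  m≡ : m ≡ sumSub α̃ (∁ F)
  m≡ = proj₂ (proj₂ (proj₂ resonant))

  A≢B : A ≢ B
  A≢B A≡B = ¬resonant (proj₁ resonant , proj₁ (proj₂ resonant) , proj₁ (proj₂ (proj₂ resonant)) , A≡B)

  sumSub-α→α̃ : ∀ B C → sumSub α B ≡ sumSub α C → sumSub α̃ B ≡ sumSub α̃ C
  sumSub-α→α̃ B C Σ≡ = sumSub-transport α α̃ α⁺ B C Σ≡
    (λ res → proj₂ (proj₂ (proj₂ (Equivalence.from (resonances _ _) (inj₁ res)))))

  sumSub-α̃→α : ∀ B C → sumSub α̃ B ≡ sumSub α̃ C → sumSub α B ≡ sumSub α C ⊎ SamePair B C F (∁ F)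
  sumSub-α̃→α B C Σ≡ with nonempty? (B ─ C) | nonempty? (C ─ B)
  ... | yes B─C≠∅ | yes C─B≠∅
    with Equivalence.to (resonances _ _) (B─C≠∅ , C─B≠∅ , ─-disjoint B C , sumSub-─⇒ α̃ B C Σ≡)
  ...   | inj₁ res                  = inj₁ (sumSub-─⇐ α B C (proj₂ (proj₂ (proj₂ res))))
  ...   | inj₂ (inj₁ (eq₁ , eq₂))   = inj₂ (inj₁ (─-complement B C F eq₁ eq₂))
  ...   | inj₂ (inj₂ (eq₁ , eq₂))   = inj₂ (inj₂ (swap (─-complement C B F eq₂ eq₁)))
  sumSub-α̃→α B C Σ≡ | no B─C=∅ | _ =
    inj₁ (sumSub-transport α̃ α α̃⁺ B C Σ≡ (λ res → ⊥-elim (B─C=∅ (proj₁ res))))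
  sumSub-α̃→α B C Σ≡ | yes _    | no C─B=∅ =
    inj₁ (sumSub-transport α̃ α α̃⁺ B C Σ≡ (λ res → ⊥-elim (C─B=∅ (proj₁ (proj₂ res)))))

  wellDefined-α→α̃ : WellDefinedOff (λ _ → ⊥) α α̃
  wellDefined-α→α̃ u p q _ = go u p q
    where
    go : ∀ {R₁ R₂} u (p : OrderedPartition α R₁ u) (q : OrderedPartition α R₂ u) → blockSums α̃ u p ≡ blockSums α̃ u q
    go []      _                      _                      = refl
    go (x ∷ u) (B , _ , _ , ΣB≡x , p) (C , _ , _ , ΣC≡x , q) =
      cong₂ _∷_ (sumSub-α→α̃ B C (trans ΣB≡x (sym ΣC≡x))) (go u p q)

  open SwapCount A B m

  private
    agree′ : ∀ {x y z u₁ u₂ ũ} → x ≡ y → Pointwise u₁ u₂ ũ → Pointwise (x ∷ u₁) (y ∷ u₂) (z ∷ ũ)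
    agree′ refl = agree
    ab′ : ∀ {x y z u₁ u₂ ũ} → x ≡ A → y ≡ B → z ≡ m →
          Pointwise u₁ u₂ ũ → Pointwise (x ∷ u₁) (y ∷ u₂) (z ∷ ũ)
    ab′ refl refl refl = ab
    ba′ : ∀ {x y z u₁ u₂ ũ} → x ≡ B → y ≡ A → z ≡ m →
          Pointwise u₁ u₂ ũ → Pointwise (x ∷ u₁) (y ∷ u₂) (z ∷ ũ)
    ba′ refl refl refl = ba

  pointwise : ∀ {R₁ R₂} u (p : OrderedPartition α̃ R₁ u) (q : OrderedPartition α̃ R₂ u) →
              Pointwise (blockSums α u p) (blockSums α u q) u
  pointwise []      _                      _                      = []
  pointwise (x ∷ u) (B , _ , _ , ΣB≡x , p) (C , _ , _ , ΣC≡x , q) with sumSub-α̃→α B C (trans ΣB≡x (sym ΣC≡x))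
  ... | inj₁ Σ≡                   = agree′ Σ≡ (pointwise u p q)
  ... | inj₂ (inj₁ (B≡F , C≡∁F)) =
    ab′ (cong (sumSub α) B≡F) (cong (sumSub α) C≡∁F) (trans (sym ΣB≡x) (cong (sumSub α̃) B≡F)) (pointwise u p q)
  ... | inj₂ (inj₂ (B≡∁F , C≡F)) =
    ba′ (cong (sumSub α) B≡∁F) (cong (sumSub α) C≡F) (trans (sym ΣB≡x) (trans (cong (sumSub α̃) B≡∁F) (sym m≡)))
        (pointwise u p q)

  wellDefined-α̃→α : WellDefinedOff (_≡ m ∷ m ∷ []) α̃ α
  wellDefined-α̃→α u p q u≢mm with pointwise-swap A≢B (pointwise u p q) (OrderedPartition-pos α⁺ _ (reweight α u p))
                                      (total p) (total q)
    where
    total : (r : Realisable α̃ u) → sumℕ (blockSums α u r) ≡ A ℕ.+ B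
    total r = trans (OrderedPartition-sum α full _ (reweight α u r)) (sumSub-∁ α F)
  ... | inj₁ eq   = eq
  ... | inj₂ u≡mm = ⊥-elim (u≢mm u≡mm)

-- Chains, and the connectivity of δ_λ

zero-chain : ∀ {λ′} l → Chain λ′ l
zero-chain l = (λ _ → 0ℤ) , (λ _ _ → refl)

zero-cycle : ∀ {λ′} l → Cycle λ′ l
zero-cycle l = zero-chain l , ∂-zero

_+[_]_ : ∀ {λ′ l} → Chain λ′ l → ℤ → Chain λ′ l → Chain λ′ l
(c , c-supp) +[ k ] (d , d-supp) =
  (λ u → c u + k * d u) ,
  λ u u∉ → trans (cong₂ (λ x y → x + k * y) (c-supp u u∉) (d-supp u u∉)) (trans (ℤₚ.+-identityˡ _) (ℤₚ.*-zeroʳ k))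

homologous-≗ : ∀ {λ′ l} (z z′ : Cycle λ′ l) → (∀ w → proj₁ (proj₁ z) w ≡ proj₁ (proj₁ z′) w) →
               Homologous λ′ l z z′
homologous-≗ {l = l} z z′ z≗z′ =
  zero-chain (suc l) ,
  λ w → trans (∂-zero w) (sym (trans (cong (_- proj₁ (proj₁ z′) w) (z≗z′ w)) (ℤₚ.+-inverseʳ (proj₁ (proj₁ z′) w))))

IsBoundary : ∀ {λ′ l} → Cycle λ′ l → Set
IsBoundary {λ′} {l} z = Σ (Chain λ′ (suc l)) λ b → ∀ w → ∂ (proj₁ b) w ≡ proj₁ (proj₁ z) w

boundary⇒homologous-0 : ∀ {λ′ l} (z : Cycle λ′ l) → IsBoundary z → Homologous λ′ l (zero-cycle l) z
boundary⇒homologous-0 z ((b , b-supp) , ∂b≡z) =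
  ((λ u → - b u) , (λ u u∉ → cong -_ (b-supp u u∉))) ,
  λ w → trans (∂-neg b w) (trans (cong -_ (∂b≡z w)) (sym (ℤₚ.+-identityˡ _)))

module Chains {t} (a : Vec ℕ t) where

  chain-support : ∀ {l} (c : Chain (toList a) l) u → proj₁ c u ≢ 0ℤ → Realisable a u × length u ≡ l
  chain-support {l} (c , c-supp) u cu≢0 with orderedPartition? a full u | length u ℕ.≟ l
  ... | yes p | yes |u|≡l = p , |u|≡l
  ... | no ¬p | _         = ⊥-elim (cu≢0 (c-supp u (λ (u∈D , _) → ¬p (InD⇒Realisable a u u∈D))))
  ... | yes _ | no |u|≢l  = ⊥-elim (cu≢0 (c-supp u (|u|≢l ∘ proj₂)))

  length-support : ∀ {l} (c : Chain (toList a) l) u → length u ≢ l → proj₁ c u ≡ 0ℤ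
  length-support c u |u|≢l with proj₁ c u ℤ.≟ 0ℤ
  ... | yes cu≡0 = cu≡0
  ... | no  cu≢0 = ⊥-elim (|u|≢l (proj₂ (chain-support c u cu≢0)))

  difference-support : ∀ {l} (c d : Chain (toList a) l) v → length v ≢ l → proj₁ c v - proj₁ d v ≡ 0ℤ
  difference-support c d v |v|≢l = cong₂ _-_ (length-support c v |v|≢l) (length-support d v |v|≢l)

  chain : ∀ {l} (f : List ℕ → ℤ) → (∀ u → f u ≢ 0ℤ → Realisable a u × length u ≡ l) → Chain (toList a) l
  chain {l} f f-supp = f , support
    where
    support : ∀ u → ¬ (InD (toList a) u × length u ≡ l) → f u ≡ 0ℤ
    support u u∉ with f u ℤ.≟ 0ℤ
    ... | yes fu≡0 = fu≡0
    ... | no  fu≢0 = ⊥-elim (u∉ (Realisable⇒InD a u (proj₁ (f-supp u fu≢0)) , proj₂ (f-supp u fu≢0)))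


LinComb : Set
LinComb = List (ℤ × List ℕ)

⟦_⟧ : LinComb → List ℕ → ℤ
⟦ []          ⟧ w = 0ℤ
⟦ (k , v) ∷ L ⟧ w = k * 𝟙[ v ] w + ⟦ L ⟧ w

⟦⟧≢0⇒∈ : ∀ L w → ⟦ L ⟧ w ≢ 0ℤ → Any ((_≡ w) ∘ proj₂) L
⟦⟧≢0⇒∈ []            w ≢0 = ⊥-elim (≢0 refl)
⟦⟧≢0⇒∈ ((k , v) ∷ L) w ≢0 with 𝟙[ v ] w ℤ.≟ 0ℤ
... | no  𝟙≢0 = Any.here (𝟙≢0⇒≡ v w 𝟙≢0)
... | yes 𝟙≡0 = Any.there (⟦⟧≢0⇒∈ L w (≢0 ∘ λ ⟦L⟧≡0 →
                  trans (cong₂ (λ x y → k * x + y) 𝟙≡0 ⟦L⟧≡0) (trans (ℤₚ.+-identityʳ _) (ℤₚ.*-zeroʳ k))))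

⟦_⟧∂ : LinComb → List ℕ → ℤ
⟦ []          ⟧∂ w = 0ℤ
⟦ (k , v) ∷ L ⟧∂ w = k * Σ< (length v ∸ 1) (λ j → signed j (𝟙[ merge j v ] w)) + ⟦ L ⟧∂ w

∂-⟦⟧ : ∀ L → All (All (1 ≤_) ∘ proj₂) L → ∀ w → ∂ ⟦ L ⟧ w ≡ ⟦ L ⟧∂ w
∂-⟦⟧ []            []          w = ∂-zero w
∂-⟦⟧ ((k , v) ∷ L) (v⁺ ∷ L⁺)   w =
  trans (∂-+ (λ u → k * 𝟙[ v ] u) ⟦ L ⟧ w)
        (cong₂ _+_ (trans (∂-*ˡ k 𝟙[ v ] w) (cong (k *_) (∂-𝟙 v v⁺ w))) (∂-⟦⟧ L L⁺ w))

module Connectivity {t} (a₀ a₁ a₂ : ℕ) (a″ : Vec ℕ t) (a⁺ : AllPos (a₀ ∷ a₁ ∷ a₂ ∷ a″)) where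

  a′ : Vec ℕ (suc (suc t))
  a′ = a₁ ∷ a₂ ∷ a″

  a : Vec ℕ (suc (suc (suc t)))
  a = a₀ ∷ a′

  open Chains a

  r n : ℕ
  r = a₂ ℕ.+ sumSub a″ full
  n = sumSub a full

  base : List ℕ
  base = a₀ ∷ (a₁ ℕ.+ r) ∷ []

  base-realisable : Realisable a base
  base-realisable = OrderedPartition-here a₀ _ (oneBlock a′ (zero , here))

  Steps : LinComb → Set
  Steps = All (λ s → Realisable a (proj₂ s) × length (proj₂ s) ≡ 3)

  Steps⇒pos : ∀ {L} → Steps L → All (All (1 ≤_) ∘ proj₂) L
  Steps⇒pos = All.map (λ (p , _) → OrderedPartition-pos a⁺ _ p)

  Steps-support : ∀ L → Steps L → ∀ u → ⟦ L ⟧ u ≢ 0ℤ → Realisable a u × length u ≡ 3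
  Steps-support L ok u ⟦L⟧u≢0 =
    All.lookupWith (λ ok-s s≡u → subst (λ v → Realisable a v × length v ≡ 3) s≡u ok-s) ok (⟦⟧≢0⇒∈ L u ⟦L⟧u≢0)

  record PathToBase (v : List ℕ) : Set where
    field
      steps    : LinComb
      steps-ok : Steps steps
      boundary : ∀ w → ∂ ⟦ steps ⟧ w ≡ 𝟙[ v ] w - 𝟙[ base ] w

  sum-pair : ∀ {x y} → Realisable a (x ∷ y ∷ []) → x ℕ.+ y ≡ a₀ ℕ.+ (a₁ ℕ.+ r)
  sum-pair {x} {y} p = trans (cong (x ℕ.+_) (sym (ℕₚ.+-identityʳ y))) (OrderedPartition-sum a full _ p)

  stay : PathToBase base
  stay = record
    { steps    = []
    ; steps-ok = []
    ; boundary = λ w → trans (∂-zero w) (sym (ℤₚ.+-inverseʳ (𝟙[ base ] w)))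
    }

  -- the one place where a third part is needed
  around : PathToBase ((a₁ ℕ.+ r) ∷ a₀ ∷ [])
  around = record { steps = L ; steps-ok = ok ; boundary = ∂L }
    where
    w₃ w₂ w₁ : List ℕ
    w₃ = a₀ ∷ a₁ ∷ r ∷ []
    w₂ = a₁ ∷ a₀ ∷ r ∷ []
    w₁ = a₁ ∷ r ∷ a₀ ∷ []
    p₃ : Realisable a w₃
    p₃ = OrderedPartition-here a₀ _ (OrderedPartition-here a₁ _ (oneBlock (a₂ ∷ a″) (zero , here)))
    p₂ : Realisable a w₂
    p₂ = OrderedPartition-swap {a = a} p₃
    p₁ : Realisable a w₁
    p₁ = let (B , B⊆ , B≠∅ , ΣB , p) = p₂ in B , B⊆ , B≠∅ , ΣB , OrderedPartition-swap {a = a} p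
    L : LinComb
    L = (1ℤ , w₃) ∷ (-1ℤ , w₂) ∷ (1ℤ , w₁) ∷ []
    ok : Steps L
    ok = (p₃ , refl) ∷ (p₂ , refl) ∷ (p₁ , refl) ∷ []
    ∂L : ∀ w → ∂ ⟦ L ⟧ w ≡ 𝟙[ (a₁ ℕ.+ r) ∷ a₀ ∷ [] ] w - 𝟙[ base ] w
    ∂L w = begin
        ∂ ⟦ L ⟧ w
      ≡⟨ ∂-⟦⟧ L (Steps⇒pos ok) w ⟩
        1ℤ * (𝟙[ (a₀ ℕ.+ a₁) ∷ r ∷ [] ] w + (- 𝟙[ base ] w + 0ℤ))
        + (-1ℤ * (𝟙[ (a₁ ℕ.+ a₀) ∷ r ∷ [] ] w + (- 𝟙[ a₁ ∷ (a₀ ℕ.+ r) ∷ [] ] w + 0ℤ))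
        + (1ℤ * (𝟙[ (a₁ ℕ.+ r) ∷ a₀ ∷ [] ] w + (- 𝟙[ a₁ ∷ (r ℕ.+ a₀) ∷ [] ] w + 0ℤ)) + 0ℤ))
      ≡⟨ cong₂ (λ s s′ → 1ℤ * (𝟙[ (a₀ ℕ.+ a₁) ∷ r ∷ [] ] w + (- 𝟙[ base ] w + 0ℤ))
                        + (-1ℤ * (𝟙[ s ∷ r ∷ [] ] w + (- 𝟙[ a₁ ∷ (a₀ ℕ.+ r) ∷ [] ] w + 0ℤ))
                        + (1ℤ * (𝟙[ (a₁ ℕ.+ r) ∷ a₀ ∷ [] ] w + (- 𝟙[ a₁ ∷ s′ ∷ [] ] w + 0ℤ)) + 0ℤ)))
               (ℕₚ.+-comm a₁ a₀) (ℕₚ.+-comm r a₀) ⟩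
        1ℤ * (𝟙[ (a₀ ℕ.+ a₁) ∷ r ∷ [] ] w + (- 𝟙[ base ] w + 0ℤ))
        + (-1ℤ * (𝟙[ (a₀ ℕ.+ a₁) ∷ r ∷ [] ] w + (- 𝟙[ a₁ ∷ (a₀ ℕ.+ r) ∷ [] ] w + 0ℤ))
        + (1ℤ * (𝟙[ (a₁ ℕ.+ r) ∷ a₀ ∷ [] ] w + (- 𝟙[ a₁ ∷ (a₀ ℕ.+ r) ∷ [] ] w + 0ℤ)) + 0ℤ))
      ≡⟨ cancel (𝟙[ (a₀ ℕ.+ a₁) ∷ r ∷ [] ] w) (𝟙[ base ] w)
                (𝟙[ a₁ ∷ (a₀ ℕ.+ r) ∷ [] ] w) (𝟙[ (a₁ ℕ.+ r) ∷ a₀ ∷ [] ] w) ⟩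
        𝟙[ (a₁ ℕ.+ r) ∷ a₀ ∷ [] ] w - 𝟙[ base ] w
      ∎
      where
      open ≡-Reasoning
      cancel : ∀ X Y Z U → 1ℤ * (X + (- Y + 0ℤ)) + (-1ℤ * (X + (- Z + 0ℤ)) + (1ℤ * (U + (- Z + 0ℤ)) + 0ℤ)) ≡ U - Y
      cancel = solve-∀

  pathToBase : ∀ x y → Realisable a (x ∷ y ∷ []) → PathToBase (x ∷ y ∷ [])
  pathToBase x y p@(true ∷ S , _ , _ , ΣB≡x , _) with nonempty? S
  ... | no S=∅ = subst PathToBase (sym xy≡base) stay
    where
    x≡a₀ : x ≡ a₀
    x≡a₀ = trans (sym ΣB≡x) (trans (cong (a₀ ℕ.+_) (sumSub-Empty a′ S=∅)) (ℕₚ.+-identityʳ a₀))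
    xy≡base : x ∷ y ∷ [] ≡ base
    xy≡base = cong₂ (λ x y → x ∷ y ∷ []) x≡a₀
                    (ℕₚ.+-cancelˡ-≡ a₀ y (a₁ ℕ.+ r) (trans (cong (ℕ._+ y) (sym x≡a₀)) (sum-pair p)))
  ... | yes S≠∅ = record { steps = L ; steps-ok = ok ; boundary = ∂L }
    where
    x′ : ℕ
    x′ = x ∸ a₀
    a₀≤x : a₀ ≤ x
    a₀≤x = subst (a₀ ≤_) ΣB≡x (ℕₚ.m≤m+n a₀ _)
    x′+y≡ : x′ ℕ.+ y ≡ a₁ ℕ.+ r
    x′+y≡ = trans (sym (ℕₚ.+-∸-comm y a₀≤x)) (trans (cong (_∸ a₀) (sum-pair p)) (ℕₚ.m+n∸m≡n a₀ (a₁ ℕ.+ r)))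
    pᵥ : Realisable a (a₀ ∷ x′ ∷ y ∷ [])
    pᵥ = subst (λ s → Realisable a (s ∷ (x ∸ s) ∷ y ∷ [])) (sumSub-⁅0⁆ a₀ a′)
               (OrderedPartition-splitFront {a = a} p (true ∷ ∅) ⁅0⁆⊆ (zero , here)
                  (Nonempty-∷ (subst Nonempty (sym (p─⊥≡p S)) S≠∅)))
    L : LinComb
    L = (1ℤ , a₀ ∷ x′ ∷ y ∷ []) ∷ []
    ok : Steps L
    ok = (pᵥ , refl) ∷ []
    ∂L : ∀ w → ∂ ⟦ L ⟧ w ≡ 𝟙[ x ∷ y ∷ [] ] w - 𝟙[ base ] w
    ∂L w = begin
        ∂ ⟦ L ⟧ w
      ≡⟨ ∂-⟦⟧ L (Steps⇒pos ok) w ⟩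
        1ℤ * (𝟙[ (a₀ ℕ.+ x′) ∷ y ∷ [] ] w + (- 𝟙[ a₀ ∷ (x′ ℕ.+ y) ∷ [] ] w + 0ℤ)) + 0ℤ
      ≡⟨ cong₂ (λ s s′ → 1ℤ * (𝟙[ s ∷ y ∷ [] ] w + (- 𝟙[ a₀ ∷ s′ ∷ [] ] w + 0ℤ)) + 0ℤ)
               (ℕₚ.m+[n∸m]≡n a₀≤x) x′+y≡ ⟩
        1ℤ * (𝟙[ x ∷ y ∷ [] ] w + (- 𝟙[ base ] w + 0ℤ)) + 0ℤ
      ≡⟨ cancel (𝟙[ x ∷ y ∷ [] ] w) (𝟙[ base ] w) ⟩
        𝟙[ x ∷ y ∷ [] ] w - 𝟙[ base ] w
      ∎
      where
      open ≡-Reasoning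
      cancel : ∀ X Y → 1ℤ * (X + (- Y + 0ℤ)) + 0ℤ ≡ X - Y
      cancel = solve-∀
  pathToBase x y (false ∷ S , _ , _ , _ , false ∷ T , _ , _ , _ , rest=∅) = ⊥-elim (rest=∅ (zero , here))
  pathToBase x y p@(false ∷ S , B⊆ , B≠∅ , ΣB≡x , true ∷ T , C⊆ , C≠∅ , ΣC≡y , rest=∅) with nonempty? T
  ... | no T=∅ = subst PathToBase (sym xy≡) around
    where
    y≡a₀ : y ≡ a₀
    y≡a₀ = trans (sym ΣC≡y) (trans (cong (a₀ ℕ.+_) (sumSub-Empty a′ T=∅)) (ℕₚ.+-identityʳ a₀))
    xy≡ : x ∷ y ∷ [] ≡ (a₁ ℕ.+ r) ∷ a₀ ∷ []
    xy≡ = cong₂ (λ x y → x ∷ y ∷ [])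
                (ℕₚ.+-cancelʳ-≡ a₀ x (a₁ ℕ.+ r)
                   (trans (cong (x ℕ.+_) (sym y≡a₀)) (trans (sum-pair p) (ℕₚ.+-comm a₀ _))))
                y≡a₀
  ... | yes T≠∅ = record { steps = L ; steps-ok = ok ; boundary = ∂L }
    where
    y′ : ℕ
    y′ = y ∸ a₀
    a₀≤y : a₀ ≤ y
    a₀≤y = subst (a₀ ≤_) ΣC≡y (ℕₚ.m≤m+n a₀ _)
    x+y′≡ : x ℕ.+ y′ ≡ a₁ ℕ.+ r
    x+y′≡ = trans (sym (ℕₚ.+-∸-assoc x a₀≤y)) (trans (cong (_∸ a₀) (sum-pair p)) (ℕₚ.m+n∸m≡n a₀ (a₁ ℕ.+ r)))
    pA : Realisable a (x ∷ a₀ ∷ y′ ∷ [])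
    pA = false ∷ S , B⊆ , B≠∅ , ΣB≡x ,
         subst (λ s → OrderedPartition a _ (s ∷ (y ∸ s) ∷ [])) (sumSub-⁅0⁆ a₀ a′)
               (OrderedPartition-splitFront {a = a} (true ∷ T , C⊆ , C≠∅ , ΣC≡y , rest=∅) (true ∷ ∅) ⁅0⁆⊆ (zero , here)
                  (Nonempty-∷ (subst Nonempty (sym (p─⊥≡p T)) T≠∅)))
    pB : Realisable a (a₀ ∷ x ∷ y′ ∷ [])
    pB = OrderedPartition-swap {a = a} pA
    L : LinComb
    L = (-1ℤ , x ∷ a₀ ∷ y′ ∷ []) ∷ (1ℤ , a₀ ∷ x ∷ y′ ∷ []) ∷ []
    ok : Steps L
    ok = (pA , refl) ∷ (pB , refl) ∷ []
    ∂L : ∀ w → ∂ ⟦ L ⟧ w ≡ 𝟙[ x ∷ y ∷ [] ] w - 𝟙[ base ] w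
    ∂L w = begin
        ∂ ⟦ L ⟧ w
      ≡⟨ ∂-⟦⟧ L (Steps⇒pos ok) w ⟩
        -1ℤ * (𝟙[ (x ℕ.+ a₀) ∷ y′ ∷ [] ] w + (- 𝟙[ x ∷ (a₀ ℕ.+ y′) ∷ [] ] w + 0ℤ))
        + (1ℤ * (𝟙[ (a₀ ℕ.+ x) ∷ y′ ∷ [] ] w + (- 𝟙[ a₀ ∷ (x ℕ.+ y′) ∷ [] ] w + 0ℤ)) + 0ℤ)
      ≡⟨ cong₃ (ℕₚ.+-comm x a₀) (ℕₚ.m+[n∸m]≡n a₀≤y) x+y′≡ ⟩
        -1ℤ * (𝟙[ (a₀ ℕ.+ x) ∷ y′ ∷ [] ] w + (- 𝟙[ x ∷ y ∷ [] ] w + 0ℤ))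
        + (1ℤ * (𝟙[ (a₀ ℕ.+ x) ∷ y′ ∷ [] ] w + (- 𝟙[ base ] w + 0ℤ)) + 0ℤ)
      ≡⟨ cancel (𝟙[ (a₀ ℕ.+ x) ∷ y′ ∷ [] ] w) (𝟙[ x ∷ y ∷ [] ] w) (𝟙[ base ] w) ⟩
        𝟙[ x ∷ y ∷ [] ] w - 𝟙[ base ] w
      ∎
      where
      open ≡-Reasoning
      cong₃ : ∀ {s₁ s₂ s₃ s₁′ s₂′ s₃′} → s₁ ≡ s₁′ → s₂ ≡ s₂′ → s₃ ≡ s₃′ →
              -1ℤ * (𝟙[ s₁ ∷ y′ ∷ [] ] w + (- 𝟙[ x ∷ s₂ ∷ [] ] w + 0ℤ))
                + (1ℤ * (𝟙[ (a₀ ℕ.+ x) ∷ y′ ∷ [] ] w + (- 𝟙[ a₀ ∷ s₃ ∷ [] ] w + 0ℤ)) + 0ℤ)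
              ≡ -1ℤ * (𝟙[ s₁′ ∷ y′ ∷ [] ] w + (- 𝟙[ x ∷ s₂′ ∷ [] ] w + 0ℤ))
                + (1ℤ * (𝟙[ (a₀ ℕ.+ x) ∷ y′ ∷ [] ] w + (- 𝟙[ a₀ ∷ s₃′ ∷ [] ] w + 0ℤ)) + 0ℤ)
      cong₃ refl refl refl = refl
      cancel : ∀ X Y Z → -1ℤ * (X + (- Y + 0ℤ)) + (1ℤ * (X + (- Z + 0ℤ)) + 0ℤ) ≡ Y - Z
      cancel = solve-∀

  vertex : ℕ → List ℕ
  vertex i = suc i ∷ (n ∸ suc i) ∷ []

  vertex-injective : ∀ {i j} → vertex i ≡ vertex j → i ≡ j
  vertex-injective refl = refl

  vertex-index : ∀ w → Realisable a w → length w ≡ 2 → ∃[ i ] i < n ∸ 1 × vertex i ≡ w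
  vertex-index (x ∷ y ∷ []) p _ with OrderedPartition-pos a⁺ _ p
  ... | 1≤x ∷ 1≤y ∷ [] = x ∸ 1 , i< , cong₂ (λ x′ y′ → x′ ∷ y′ ∷ []) sx (trans (cong (n ∸_) sx) n∸x≡y)
    where
    x+y≡n : x ℕ.+ y ≡ n
    x+y≡n = trans (cong (x ℕ.+_) (sym (ℕₚ.+-identityʳ y))) (OrderedPartition-sum a full _ p)
    sx : suc (x ∸ 1) ≡ x
    sx = ℕₚ.m+[n∸m]≡n 1≤x
    n∸x≡y : n ∸ x ≡ y
    n∸x≡y = trans (cong (_∸ x) (sym x+y≡n)) (ℕₚ.m+n∸m≡n x y)
    i< : x ∸ 1 < n ∸ 1
    i< = ℕₚ.∸-monoˡ-< (subst (x <_) x+y≡n (ℕₚ.m<m+n x 1≤y)) 1≤x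

  Σ<-vertices : ∀ (z : Chain (toList a) 2) w → Σ< (n ∸ 1) (λ i → proj₁ z (vertex i) * 𝟙[ vertex i ] w) ≡ proj₁ z w
  Σ<-vertices (z , z-supp) w with z w ℤ.≟ 0ℤ
  ... | yes zw≡0 = trans (Σ<-zero (n ∸ 1) term≡0) (sym zw≡0)
    where
    term≡0 : ∀ i → z (vertex i) * 𝟙[ vertex i ] w ≡ 0ℤ
    term≡0 i with 𝟙[ vertex i ] w ℤ.≟ 0ℤ
    ... | yes 𝟙≡0 = trans (cong (z (vertex i) *_) 𝟙≡0) (ℤₚ.*-zeroʳ (z (vertex i)))
    ... | no  𝟙≢0 = trans (cong (λ v → z v * 𝟙[ vertex i ] w) (𝟙≢0⇒≡ (vertex i) w 𝟙≢0))
                          (trans (cong (_* 𝟙[ vertex i ] w) zw≡0) (ℤₚ.*-zeroˡ (𝟙[ vertex i ] w)))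
  ... | no  zw≢0 with chain-support (z , z-supp) w zw≢0
  ...   | p , |w|≡2 with vertex-index w p |w|≡2
  ...     | i₀ , i₀< , refl =
    trans (Σ<-single (n ∸ 1) i₀ i₀< (λ i _ i≢i₀ → trans (cong (z (vertex i) *_) (𝟙-≢ _ _ (i≢i₀ ∘ vertex-injective)))
                                                          (ℤₚ.*-zeroʳ (z (vertex i)))))
          (trans (cong (z (vertex i₀) *_) (𝟙-refl (vertex i₀))) (ℤₚ.*-identityʳ (z (vertex i₀))))

  -- cycles of length l live in reduced degree l - 2: these are H̃₋₂, H̃₋₁ and H̃₀
  vanishing₀ : ∀ (z : Cycle (toList a) 0) → IsBoundary z
  vanishing₀ ((z , z-supp) , _) = zero-chain 1 , λ w → trans (∂-zero w) (sym (z≡0 w))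
    where
    z≡0 : ∀ w → z w ≡ 0ℤ
    z≡0 w with z w ℤ.≟ 0ℤ
    ... | yes zw≡0 = zw≡0
    ... | no  zw≢0 with chain-support (z , z-supp) w zw≢0
    ...   | p , |w|≡0 with w
    ...     | [] = ⊥-elim (¬Realisable-[] a (s≤s z≤n) p)

  vanishing₁ : ∀ (z : Cycle (toList a) 1) → IsBoundary z
  vanishing₁ ((z , z-supp) , _) = chain b b-supp , λ w → trans (∂b w) (sym (z-expansion w))
    where
    b : List ℕ → ℤ
    b u = z (n ∷ []) * 𝟙[ base ] u
    b-supp : ∀ u → b u ≢ 0ℤ → Realisable a u × length u ≡ 2
    b-supp u bu≢0
      with 𝟙≢0⇒≡ base u (λ 𝟙≡0 → bu≢0 (trans (cong (z (n ∷ []) *_) 𝟙≡0) (ℤₚ.*-zeroʳ (z (n ∷ [])))))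
    ... | refl = base-realisable , refl
    ∂b : ∀ w → ∂ b w ≡ z (n ∷ []) * 𝟙[ n ∷ [] ] w
    ∂b w = trans (∂-*ˡ (z (n ∷ [])) 𝟙[ base ] w)
                 (cong (z (n ∷ []) *_) (trans (∂-𝟙 base (OrderedPartition-pos a⁺ _ base-realisable) w) (ℤₚ.+-identityʳ _)))
    z-expansion : ∀ w → z w ≡ z (n ∷ []) * 𝟙[ n ∷ [] ] w
    z-expansion w with z w ℤ.≟ 0ℤ
    ... | yes zw≡0 = trans zw≡0 (sym (𝟙-side w zw≡0))
      where
      𝟙-side : ∀ w → z w ≡ 0ℤ → z (n ∷ []) * 𝟙[ n ∷ [] ] w ≡ 0ℤ
      𝟙-side w zw≡0 with 𝟙[ n ∷ [] ] w ℤ.≟ 0ℤ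
      ... | yes 𝟙≡0 = trans (cong (z (n ∷ []) *_) 𝟙≡0) (ℤₚ.*-zeroʳ (z (n ∷ [])))
      ... | no  𝟙≢0 with 𝟙≢0⇒≡ (n ∷ []) w 𝟙≢0
      ...   | refl = trans (cong (_* 𝟙[ n ∷ [] ] w) zw≡0) (ℤₚ.*-zeroˡ (𝟙[ n ∷ [] ] w))
    ... | no  zw≢0 with chain-support (z , z-supp) w zw≢0
    ...   | p , |w|≡1 with w
    ...     | x ∷ [] with trans (sym (ℕₚ.+-identityʳ x)) (OrderedPartition-sum a full _ p)
    ...       | refl = sym (trans (cong (z (n ∷ []) *_) (𝟙-refl (n ∷ []))) (ℤₚ.*-identityʳ (z (n ∷ []))))

  stepsFrom : ∀ i → Dec (Realisable a (vertex i)) → LinComb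
  stepsFrom i (yes p) = PathToBase.steps (pathToBase _ _ p)
  stepsFrom i (no  _) = []

  stepsFrom-ok : ∀ i d → Steps (stepsFrom i d)
  stepsFrom-ok i (yes p) = PathToBase.steps-ok (pathToBase _ _ p)
  stepsFrom-ok i (no  _) = []

  vanishing₂ : ∀ (z : Cycle (toList a) 2) → IsBoundary z
  vanishing₂ ((z , z-supp) , z-cycle) = boundary-via (λ i → orderedPartition? a full (vertex i))
    where
    -- taking the decisions as a parameter keeps the type checker from evaluating orderedPartition?
    boundary-via : (∀ i → Dec (Realisable a (vertex i))) → IsBoundary ((z , z-supp) , z-cycle)
    boundary-via d = chain b b-supp , ∂b≡z
      where
      path : ℕ → LinComb
      path i = stepsFrom i (d i)
      b : List ℕ → ℤ
      b u = Σ< (n ∸ 1) (λ i → z (vertex i) * ⟦ path i ⟧ u)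
      b-supp : ∀ u → b u ≢ 0ℤ → Realisable a u × length u ≡ 3
      b-supp u bu≢0 =
        let (i , _ , term≢0) = Σ<≢0⇒∃ (n ∸ 1) (λ i → z (vertex i) * ⟦ path i ⟧ u) bu≢0 in
        Steps-support (path i) (stepsFrom-ok i (d i)) u
          (λ ⟦⟧≡0 → term≢0 (trans (cong (z (vertex i) *_) ⟦⟧≡0) (ℤₚ.*-zeroʳ (z (vertex i)))))
      ∂path : ∀ i w → z (vertex i) * ∂ ⟦ path i ⟧ w ≡ z (vertex i) * (𝟙[ vertex i ] w - 𝟙[ base ] w)
      ∂path i w with d i
      ... | yes p  = cong (z (vertex i) *_) (PathToBase.boundary (pathToBase _ _ p) w)
      ... | no  ¬p =
        trans (cong (z (vertex i) *_) (∂-zero w))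
              (trans (ℤₚ.*-zeroʳ (z (vertex i)))
                     (sym (trans (cong (_* (𝟙[ vertex i ] w - 𝟙[ base ] w)) zero-at-vertex)
                                 (ℤₚ.*-zeroˡ (𝟙[ vertex i ] w - 𝟙[ base ] w)))))
        where
        zero-at-vertex : z (vertex i) ≡ 0ℤ
        zero-at-vertex with z (vertex i) ℤ.≟ 0ℤ
        ... | yes ≡0 = ≡0
        ... | no  ≢0 = ⊥-elim (¬p (proj₁ (chain-support (z , z-supp) (vertex i) ≢0)))
      Σz≡0 : Σ< (n ∸ 1) (λ i → z (vertex i)) ≡ 0ℤ
      Σz≡0 = trans (sym (∂-[ n ] z)) (z-cycle (n ∷ []))
      ∂b≡z : ∀ w → ∂ b w ≡ z w
      ∂b≡z w = begin
          ∂ b w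
        ≡⟨ ∂-Σ< (n ∸ 1) (λ i u → z (vertex i) * ⟦ path i ⟧ u) w ⟩
          Σ< (n ∸ 1) (λ i → ∂ (λ u → z (vertex i) * ⟦ path i ⟧ u) w)
        ≡⟨ Σ<-cong (n ∸ 1) (λ i → trans (∂-*ˡ (z (vertex i)) ⟦ path i ⟧ w) (∂path i w)) ⟩
          Σ< (n ∸ 1) (λ i → z (vertex i) * (𝟙[ vertex i ] w - 𝟙[ base ] w))
        ≡⟨ Σ<-cong (n ∸ 1) (λ i → distrib (z (vertex i)) (𝟙[ vertex i ] w) (𝟙[ base ] w)) ⟩
          Σ< (n ∸ 1) (λ i → z (vertex i) * 𝟙[ vertex i ] w + - (𝟙[ base ] w * z (vertex i)))
        ≡⟨ trans (Σ<-+ (n ∸ 1) _ _) (cong (Σ< (n ∸ 1) (λ i → z (vertex i) * 𝟙[ vertex i ] w) +_)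
                                          (trans (Σ<-neg (n ∸ 1) _) (cong -_ (Σ<-*ˡ (n ∸ 1) (𝟙[ base ] w) (λ i → z (vertex i)))))) ⟩
          Σ< (n ∸ 1) (λ i → z (vertex i) * 𝟙[ vertex i ] w) + - (𝟙[ base ] w * Σ< (n ∸ 1) (λ i → z (vertex i)))
        ≡⟨ cong₂ (λ X Y → X + - (𝟙[ base ] w * Y)) (Σ<-vertices (z , z-supp) w) Σz≡0 ⟩
          z w + - (𝟙[ base ] w * 0ℤ)
        ≡⟨ drop (z w) (𝟙[ base ] w) ⟩
          z w
        ∎
        where
        open ≡-Reasoning
        distrib : ∀ Z X B → Z * (X - B) ≡ Z * X + - (B * Z)
        distrib = solve-∀
        drop : ∀ Z B → Z + - (B * 0ℤ) ≡ Z
        drop = solve-∀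

-- Pulling back chains along a transfer

module Pullback {t} (a b : Vec ℕ t) (a⁺ : AllPos a) (b⁺ : AllPos b) (1≤t : 1 ≤ t)
  (Eᵃ Eᵇ : List ℕ → Set) (Eᵃ-short : ∀ u → Eᵃ u → length u ≡ 2) (Eᵇ-short : ∀ u → Eᵇ u → length u ≡ 2)
  (wdᵃᵇ : WellDefinedOff Eᵃ a b) (wdᵇᵃ : WellDefinedOff Eᵇ b a) where

  open Commutation a b a⁺ b⁺ 1≤t Eᵃ Eᵇ Eᵃ-short Eᵇ-short wdᵃᵇ wdᵇᵃ public
  private
    module A = Chains a
    module B = Chains b

  pullback : ∀ {l} → Chain (toList b) l → Chain (toList a) l
  pullback {l} c = A.chain (proj₁ c ∘ Φ) support
    where
    support : ∀ u → proj₁ c (Φ u) ≢ 0ℤ → Realisable a u × length u ≡ l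
    support u c∘Φ≢0 with B.chain-support c (Φ u) c∘Φ≢0
    ... | pᵦ , |Φu|≡l = pₐ , trans (sym (transfer-length a b u pₐ)) |Φu|≡l
      where
      pₐ : Realisable a u
      pₐ = transfer-reflects a b 1≤t u pᵦ

  ¬Eᵇ-transfer : ∀ w → 3 ≤ length w → ¬ Eᵇ (Φ w)
  ¬Eᵇ-transfer w 3≤w EᵇΦw = by-cases (orderedPartition? a full w)
    where
    by-cases : Dec (Realisable a w) → ⊥
    by-cases (yes p)  = long⇒¬short Eᵇ-short (Φ w) (subst (3 ≤_) (sym (transfer-length a b w p)) 3≤w) EᵇΦw
    by-cases (no  ¬p) with trans (sym (cong length (transfer-unrealisable a b w ¬p))) (Eᵇ-short (Φ w) EᵇΦw)
    ... | ()

  ∂-pullback : ∀ {l} (c : Chain (toList b) l) w → 3 ≤ length w → ∂ (proj₁ c ∘ Φ) w ≡ ∂ (proj₁ c) (Φ w)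
  ∂-pullback c w 3≤w =
    ∂-transfer (proj₁ c) (λ u cu≢0 → proj₁ (B.chain-support c u cu≢0)) w
               (ℕₚ.≤-trans (s≤s (s≤s z≤n)) 3≤w) (long⇒¬short Eᵃ-short w 3≤w) (¬Eᵇ-transfer w 3≤w)

  pullback-cycle : ∀ l → 4 ≤ l → Cycle (toList b) l → Cycle (toList a) l
  pullback-cycle l 4≤l (c , c-cycle) = pullback c , is-cycle
    where
    is-cycle : ∀ w → ∂ (proj₁ c ∘ Φ) w ≡ 0ℤ
    is-cycle w with suc (length w) ℕ.≟ l
    ... | no  |w|+1≢l = ∂-length l (proj₁ c ∘ Φ) w (A.length-support (pullback c)) |w|+1≢l
    ... | yes refl    = trans (∂-pullback c w (ℕₚ.≤-pred 4≤l)) (c-cycle (Φ w))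

  pullback-boundary : ∀ l → 3 ≤ l → (β : Chain (toList b) (suc l)) (f : List ℕ → ℤ) →
                      (∀ v → length v ≢ l → f v ≡ 0ℤ) → (∀ w → ∂ (proj₁ β) w ≡ f w) →
                      ∀ w → ∂ (proj₁ β ∘ Φ) w ≡ f (Φ w)
  pullback-boundary l 3≤l β f f-supp ∂β≡f w with length w ℕ.≟ l
  ... | yes refl = trans (∂-pullback β w 3≤l) (∂β≡f (Φ w))
  ... | no |w|≢l =
    trans (∂-length (suc l) (proj₁ β ∘ Φ) w (A.length-support (pullback β)) (|w|≢l ∘ ℕₚ.suc-injective))
          (sym (f-supp (Φ w) |Φw|≢l))
    where
    |Φw|≢l : length (Φ w) ≢ l
    |Φw|≢l = by-cases (orderedPartition? a full w)
      where
      0≢l : 0 ≢ l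
      0≢l 0≡l with subst (3 ≤_) (sym 0≡l) 3≤l
      ... | ()
      by-cases : Dec (Realisable a w) → length (Φ w) ≢ l
      by-cases (yes p)  = |w|≢l ∘ trans (sym (transfer-length a b w p))
      by-cases (no  ¬p) = 0≢l ∘ trans (sym (cong length (transfer-unrealisable a b w ¬p)))

  pullback-pullback : ∀ l → 3 ≤ l → (c : Chain (toList a) l) → ∀ w → proj₁ c (Ψ (Φ w)) ≡ proj₁ c w
  pullback-pullback l 3≤l c w with proj₁ c w ℤ.≟ 0ℤ
  ... | no cw≢0 with A.chain-support c w cw≢0
  ...   | p , refl = cong (proj₁ c) (transfer-transfer a b wdᵇᵃ w p (¬Eᵇ-transfer w 3≤l))
  pullback-pullback l 3≤l c w | yes cw≡0 with proj₁ c (Ψ (Φ w)) ℤ.≟ 0ℤ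
  ... | yes cΨΦw≡0 = trans cΨΦw≡0 (sym cw≡0)
  ... | no  cΨΦw≢0 = ⊥-elim (cΨΦw≢0 (trans (cong (proj₁ c) ΨΦw≡w) cw≡0))
    where
    support : Realisable a (Ψ (Φ w)) × length (Ψ (Φ w)) ≡ l
    support = A.chain-support c (Ψ (Φ w)) cΨΦw≢0
    pᵦ : Realisable b (Φ w)
    pᵦ = transfer-reflects b a 1≤t (Φ w) (proj₁ support)
    pₐ : Realisable a w
    pₐ = transfer-reflects a b 1≤t w pᵦ
    |w|≡l : length w ≡ l
    |w|≡l = trans (sym (transfer-length a b w pₐ)) (trans (sym (transfer-length b a (Φ w) pᵦ)) (proj₂ support))
    ΨΦw≡w : Ψ (Φ w) ≡ w
    ΨΦw≡w = transfer-transfer a b wdᵇᵃ w pₐ (¬Eᵇ-transfer w (subst (3 ≤_) (sym |w|≡l) 3≤l))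

  pullback-homologous : ∀ l (4≤l : 4 ≤ l) x y → Homologous (toList b) l x y →
                        Homologous (toList a) l (pullback-cycle l 4≤l x) (pullback-cycle l 4≤l y)
  pullback-homologous l 4≤l (x , _) (y , _) (β , ∂β≡x-y) =
    pullback β ,
    pullback-boundary l (ℕₚ.≤-trans (ℕₚ.n≤1+n 3) 4≤l) β (λ v → proj₁ x v - proj₁ y v)
      (B.difference-support x y) ∂β≡x-y

-- Homology

≅-trivial : ∀ {λ₁ λ₂} l → (∀ (z : Cycle λ₁ l) → IsBoundary z) → (∀ (z : Cycle λ₂ l) → IsBoundary z) →
            H̃ λ₂ l ≅ (H̃ λ₁ l ⊕ trivial-grp)
≅-trivial l bd₁ bd₂ = record
  { to        = λ _ → zero-cycle l , tt
  ; from      = λ _ → zero-cycle l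
  ; to-cong   = λ _ → homologous-≗ (zero-cycle l) (zero-cycle l) (λ _ → refl) , tt
  ; from-cong = λ _ → homologous-≗ (zero-cycle l) (zero-cycle l) (λ _ → refl)
  ; to-hom    = λ _ _ → homologous-≗ (zero-cycle l) (addCycle _ l (zero-cycle l) (zero-cycle l)) (λ _ → refl) , tt
  ; to-from   = λ y → boundary⇒homologous-0 (proj₁ y) (bd₁ (proj₁ y)) , tt
  ; from-to   = λ x → boundary⇒homologous-0 x (bd₂ x)
  }

module AddedResonance {t} (a₀ a₁ a₂ : ℕ) (a″ : Vec ℕ t) (b₀ b₁ b₂ : ℕ) (b″ : Vec ℕ t)
  (α⁺ : AllPos (a₀ ∷ a₁ ∷ a₂ ∷ a″)) (α̃⁺ : AllPos (b₀ ∷ b₁ ∷ b₂ ∷ b″)) (F : Subset (suc (suc (suc t))))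
  (¬resonant : ¬ IsResonance (a₀ ∷ a₁ ∷ a₂ ∷ a″) F (∁ F))
  (resonances : ∀ I J → IsResonance (b₀ ∷ b₁ ∷ b₂ ∷ b″) I J ⇔
                        (IsResonance (a₀ ∷ a₁ ∷ a₂ ∷ a″) I J ⊎ SamePair I J F (∁ F))) where

  α α̃ : Vec ℕ (suc (suc (suc t)))
  α = a₀ ∷ a₁ ∷ a₂ ∷ a″
  α̃ = b₀ ∷ b₁ ∷ b₂ ∷ b″

  open NewResonance α α̃ α⁺ α̃⁺ F ¬resonant resonances

  MM : List ℕ
  MM = m ∷ m ∷ []

  MM-short : ∀ u → u ≡ MM → length u ≡ 2
  MM-short _ refl = refl

  module Φ* = Pullback α α̃ α⁺ α̃⁺ (s≤s z≤n) (λ _ → ⊥) (_≡ MM) (λ _ ()) MM-short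
                      wellDefined-α→α̃ wellDefined-α̃→α
  module Ψ* = Pullback α̃ α α̃⁺ α⁺ (s≤s z≤n) (_≡ MM) (λ _ → ⊥) MM-short (λ _ ())
                      wellDefined-α̃→α wellDefined-α→α̃

  ≅-high : ∀ l → 4 ≤ l → H̃ (toList α̃) l ≅ (H̃ (toList α) l ⊕ trivial-grp)
  ≅-high l 4≤l = record
    { to        = λ z → Φ*.pullback-cycle l 4≤l z , tt
    ; from      = λ y → Ψ*.pullback-cycle l 4≤l (proj₁ y)
    ; to-cong   = λ {x} {y} x~y → Φ*.pullback-homologous l 4≤l x y x~y , tt
    ; from-cong = λ {x} {y} x~y → Ψ*.pullback-homologous l 4≤l (proj₁ x) (proj₁ y) (proj₁ x~y)
    ; to-hom    = λ x y → homologous-≗ (Φ*.pullback-cycle l 4≤l (addCycle _ l x y))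
                                         (addCycle _ l (Φ*.pullback-cycle l 4≤l x) (Φ*.pullback-cycle l 4≤l y)) (λ _ → refl) , tt
    ; to-from   = λ y → homologous-≗ (Φ*.pullback-cycle l 4≤l (Ψ*.pullback-cycle l 4≤l (proj₁ y))) (proj₁ y)
                                     (Φ*.pullback-pullback l 3≤l (proj₁ (proj₁ y))) , tt
    ; from-to   = λ x → homologous-≗ (Ψ*.pullback-cycle l 4≤l (Φ*.pullback-cycle l 4≤l x)) x
                                     (Ψ*.pullback-pullback l 3≤l (proj₁ x))
    }
    where
    3≤l : 3 ≤ l
    3≤l = ℕₚ.≤-trans (ℕₚ.n≤1+n 3) 4≤l

  module Cα  = Chains α
  module Cα̃  = Chains α̃
  module Kα  = Connectivity a₀ a₁ a₂ a″ α⁺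
  module Kα̃  = Connectivity b₀ b₁ b₂ b″ α̃⁺

  Φ Ψ : List ℕ → List ℕ
  Φ = transfer α α̃
  Ψ = transfer α̃ α

  AB BA : List ℕ
  AB = A ∷ B ∷ []
  BA = B ∷ A ∷ []

  AB-realisable : Realisable α AB
  AB-realisable = twoBlocks α F (proj₁ resonant) (proj₁ (proj₂ resonant))

  BA-realisable : Realisable α BA
  BA-realisable = OrderedPartition-swap {a = α} AB-realisable

  A+B≡n : A ℕ.+ B ≡ Kα.n
  A+B≡n = sym (sumSub-∁ α F)

  MM-realisable : Realisable α̃ MM
  MM-realisable = subst (λ x → Realisable α̃ (m ∷ x ∷ [])) (sym m≡) (twoBlocks α̃ F (proj₁ resonant) (proj₁ (proj₂ resonant)))

  Φ-AB : Φ AB ≡ MM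
  Φ-AB = let (q , Φ≡) = transfer-realisable α α̃ AB AB-realisable in
         trans Φ≡ (trans (wellDefined-α→α̃ AB q AB-realisable (λ ())) (cong (λ y → m ∷ y ∷ []) (sym m≡)))

  Φ-BA : Φ BA ≡ MM
  Φ-BA = let (q , Φ≡) = transfer-realisable α α̃ BA BA-realisable in
         trans Φ≡ (trans (wellDefined-α→α̃ BA q BA-realisable (λ ())) (cong (λ x → x ∷ m ∷ []) (sym m≡)))

  Φ≡MM : ∀ w → Φ w ≡ MM → w ≡ AB ⊎ w ≡ BA
  Φ≡MM w Φw≡MM = by-cases (orderedPartition? α full w)
    where
    first-part : ∀ x y (p : Realisable α (x ∷ y ∷ [])) → blockSums {a = α} α̃ (x ∷ y ∷ []) p ≡ MM → x ≡ A ⊎ x ≡ B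
    first-part x y (B₁ , _ , _ , ΣB₁≡x , _) bs≡MM = by-block (sumSub-α̃→α B₁ F (Listₚ.∷-injectiveˡ bs≡MM))
      where
      by-block : sumSub α B₁ ≡ A ⊎ SamePair B₁ F F (∁ F) → x ≡ A ⊎ x ≡ B
      by-block (inj₁ Σ≡)                 = inj₁ (trans (sym ΣB₁≡x) Σ≡)
      by-block (inj₂ (inj₁ (B₁≡F , _)))  = inj₁ (trans (sym ΣB₁≡x) (cong (sumSub α) B₁≡F))
      by-block (inj₂ (inj₂ (B₁≡∁F , _))) = inj₂ (trans (sym ΣB₁≡x) (cong (sumSub α) B₁≡∁F))
    two-parts : ∀ x y → Realisable α (x ∷ y ∷ []) → ∀ A′ B′ → A′ ℕ.+ B′ ≡ Kα.n → x ≡ A′ →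
                x ∷ y ∷ [] ≡ A′ ∷ B′ ∷ []
    two-parts x y p A′ B′ A′+B′≡n refl =
      cong (λ y → x ∷ y ∷ []) (ℕₚ.+-cancelˡ-≡ x y B′ (trans (cong (x ℕ.+_) (sym (ℕₚ.+-identityʳ y)))
                                                          (trans (OrderedPartition-sum α full _ p) (sym A′+B′≡n))))
    realised : ∀ w (p : Realisable α w) → blockSums {a = α} α̃ w p ≡ MM → w ≡ AB ⊎ w ≡ BA
    realised (x ∷ y ∷ []) p bs≡MM with first-part x y p bs≡MM
    ... | inj₁ x≡A = inj₁ (two-parts x y p A B A+B≡n x≡A)
    ... | inj₂ x≡B = inj₂ (two-parts x y p B A (trans (ℕₚ.+-comm B A) A+B≡n) x≡B)
    realised []                 _                   ()
    realised (x ∷ [])           (_ , _ , _ , _ , _) ()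
    realised (x ∷ y ∷ z ∷ w)    (_ , _ , _ , _ , _ , _ , _ , _ , _ , _ , _ , _ , _) ()
    by-cases : Dec (Realisable α w) → w ≡ AB ⊎ w ≡ BA
    by-cases (yes p₀) = let (p , Φ≡) = transfer-realisable α α̃ w p₀ in realised w p (trans (sym Φ≡) Φw≡MM)
    by-cases (no ¬p) with trans (sym (transfer-unrealisable α α̃ w ¬p)) Φw≡MM
    ... | ()

  module Path-AB = Kα.PathToBase (Kα.pathToBase A B AB-realisable)
  module Path-BA = Kα.PathToBase (Kα.pathToBase B A BA-realisable)

  γf : List ℕ → ℤ
  γf u = ⟦ Path-AB.steps ⟧ u - ⟦ Path-BA.steps ⟧ u

  -- a path from BA to AB in δ_λ; it becomes the new 1-cycle once AB and BA are identified
  γ : Chain (toList α) 3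
  γ = Cα.chain γf support
    where
    support : ∀ u → γf u ≢ 0ℤ → Realisable α u × length u ≡ 3
    support u γu≢0 with ⟦ Path-AB.steps ⟧ u ℤ.≟ 0ℤ
    ... | no  AB≢0 = Kα.Steps-support Path-AB.steps Path-AB.steps-ok u AB≢0
    ... | yes AB≡0 = Kα.Steps-support Path-BA.steps Path-BA.steps-ok u (λ BA≡0 → γu≢0 (cong₂ _-_ AB≡0 BA≡0))

  ∂γ : ∀ w → ∂ γf w ≡ 𝟙[ AB ] w - 𝟙[ BA ] w
  ∂γ w = trans (∂-- ⟦ Path-AB.steps ⟧ ⟦ Path-BA.steps ⟧ w)
               (trans (cong₂ _-_ (Path-AB.boundary w) (Path-BA.boundary w)) (cancel (𝟙[ AB ] w) (𝟙[ BA ] w) (𝟙[ Kα.base ] w)))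
    where
    cancel : ∀ X Y Z → (X - Z) - (Y - Z) ≡ X - Y
    cancel = solve-∀

  vertex-AB : ∃[ i ] i < Kα.n ∸ 1 × Kα.vertex i ≡ AB
  vertex-AB = Kα.vertex-index AB AB-realisable refl

  vertex-BA : ∃[ i ] i < Kα.n ∸ 1 × Kα.vertex i ≡ BA
  vertex-BA = Kα.vertex-index BA BA-realisable refl

  pulled : Cycle (toList α̃) 3 → List ℕ → ℤ
  pulled z = proj₁ (proj₁ z) ∘ Φ

  coeff : Cycle (toList α̃) 3 → ℤ
  coeff z = ∂ (pulled z) AB

  ∂pulled-vanishes : ∀ z w → w ≢ AB → w ≢ BA → ∂ (pulled z) w ≡ 0ℤ
  ∂pulled-vanishes z w w≢AB w≢BA with length w ℕ.≟ 2
  ... | no  |w|≢2 = ∂-length 3 (pulled z) w (Cα.length-support (Φ*.pullback (proj₁ z))) (|w|≢2 ∘ ℕₚ.suc-injective)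
  ... | yes |w|≡2 =
    trans (Φ*.∂-transfer (proj₁ (proj₁ z)) (λ u zu≢0 → proj₁ (Cα̃.chain-support (proj₁ z) u zu≢0)) w
                         (subst (2 ≤_) (sym |w|≡2) ℕₚ.≤-refl) (λ ()) Φw≢MM)
          (proj₂ z (Φ w))
    where
    Φw≢MM : Φ w ≢ MM
    Φw≢MM Φw≡MM with Φ≡MM w Φw≡MM
    ... | inj₁ w≡AB = w≢AB w≡AB
    ... | inj₂ w≡BA = w≢BA w≡BA

  ∂pulled-AB+BA : ∀ z → ∂ (pulled z) AB + ∂ (pulled z) BA ≡ 0ℤ
  ∂pulled-AB+BA z with vertex-AB | vertex-BA
  ... | i , i< , vi≡AB | j , j< , vj≡BA =
    trans (sym (cong₂ (λ u v → ∂ (pulled z) u + ∂ (pulled z) v) vi≡AB vj≡BA))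
          (trans (sym (Σ<-pair (Kα.n ∸ 1) i j i≢j i< j< off))
                 (trans (sym (∂-[ Kα.n ] (∂ (pulled z)))) (∂∂ (pulled z) (Kα.n ∷ []))))
    where
    i≢j : i ≢ j
    i≢j refl = A≢B (Listₚ.∷-injectiveˡ (trans (sym vi≡AB) vj≡BA))
    off : ∀ k → k < Kα.n ∸ 1 → k ≢ i → k ≢ j → ∂ (pulled z) (Kα.vertex k) ≡ 0ℤ
    off k _ k≢i k≢j = ∂pulled-vanishes z (Kα.vertex k) (λ vk≡AB → k≢i (Kα.vertex-injective (trans vk≡AB (sym vi≡AB))))
                                        (λ vk≡BA → k≢j (Kα.vertex-injective (trans vk≡BA (sym vj≡BA))))

  AB≢BA : AB ≢ BA
  AB≢BA = A≢B ∘ Listₚ.∷-injectiveˡ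

  ∂pulled : ∀ z w → ∂ (pulled z) w ≡ coeff z * (𝟙[ AB ] w - 𝟙[ BA ] w)
  ∂pulled z w with Listₚ.≡-dec ℕ._≟_ w AB | Listₚ.≡-dec ℕ._≟_ w BA
  ... | yes refl | _        = sym (trans (cong₂ (λ x y → coeff z * (x - y)) (𝟙-refl AB) (𝟙-≢ BA AB (AB≢BA ∘ sym)))
                                         (ℤₚ.*-identityʳ (coeff z)))
  ... | no _     | yes refl =
    trans (shift (coeff z) (∂ (pulled z) BA))
          (trans (cong (- coeff z +_) (∂pulled-AB+BA z))
                 (sym (trans (cong₂ (λ x y → coeff z * (x - y)) (𝟙-≢ AB BA AB≢BA) (𝟙-refl BA)) (negate (coeff z)))))
    where
    shift : ∀ c d → d ≡ - c + (c + d)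
    shift = solve-∀
    negate : ∀ c → c * (0ℤ - 1ℤ) ≡ - c + 0ℤ
    negate = solve-∀
  ... | no w≢AB  | no w≢BA  = trans (∂pulled-vanishes z w w≢AB w≢BA)
                                    (sym (trans (cong₂ (λ x y → coeff z * (x - y)) (𝟙-≢ AB w (w≢AB ∘ sym)) (𝟙-≢ BA w (w≢BA ∘ sym)))
                                                (ℤₚ.*-zeroʳ (coeff z))))

  private
    linear : ∀ f k g w → ∂ (λ u → f u + k * g u) w ≡ ∂ f w + k * ∂ g w
    linear f k g w = trans (∂-+ f (λ u → k * g u) w) (cong (∂ f w +_) (∂-*ˡ k g w))

  to-cycle : Cycle (toList α̃) 3 → Cycle (toList α) 3
  to-cycle z = Φ*.pullback (proj₁ z) +[ - coeff z ] γ , is-cycle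
    where
    is-cycle : ∀ w → ∂ (λ u → pulled z u + (- coeff z) * γf u) w ≡ 0ℤ
    is-cycle w = trans (linear (pulled z) (- coeff z) γf w)
                       (trans (cong₂ (λ x y → x + (- coeff z) * y) (∂pulled z w) (∂γ w)) (cancel (coeff z) _))
      where
      cancel : ∀ c Δ → c * Δ + (- c) * Δ ≡ 0ℤ
      cancel = solve-∀

  Ψ-avoids : ∀ w̃ v → Φ v ≡ MM → w̃ ≢ MM → Ψ w̃ ≢ v
  Ψ-avoids w̃ v Φv≡MM w̃≢MM Ψw̃≡v = by-cases (orderedPartition? α̃ full w̃)
    where
    by-cases : Dec (Realisable α̃ w̃) → ⊥
    by-cases (yes p) =
      w̃≢MM (trans (sym (transfer-transfer α̃ α wellDefined-α→α̃ w̃ p (λ ()))) (trans (cong Φ Ψw̃≡v) Φv≡MM))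
    by-cases (no ¬p) = []≢MM (trans (sym (transfer-unrealisable α α̃ [] (¬Realisable-[] α (s≤s z≤n))))
                                    (trans (cong Φ (trans (sym (transfer-unrealisable α̃ α w̃ ¬p)) Ψw̃≡v)) Φv≡MM))
      where
      []≢MM : [] ≢ MM
      []≢MM ()

  from-cycle : Cycle (toList α) 3 → ℤ → Cycle (toList α̃) 3
  from-cycle z c = Ψ*.pullback (proj₁ z +[ c ] γ) , is-cycle
    where
    g : List ℕ → ℤ
    g u = proj₁ (proj₁ z) u + c * γf u
    ∂g : ∀ v → ∂ g v ≡ c * (𝟙[ AB ] v - 𝟙[ BA ] v)
    ∂g v = trans (linear (proj₁ (proj₁ z)) c γf v)
                 (trans (cong₂ (λ x y → x + c * y) (proj₂ z v) (∂γ v)) (ℤₚ.+-identityˡ _))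
    ∂g∘Ψ-vanishes : ∀ w̃ → w̃ ≢ MM → ∂ (g ∘ Ψ) w̃ ≡ 0ℤ
    ∂g∘Ψ-vanishes w̃ w̃≢MM with length w̃ ℕ.≟ 2
    ... | no  |w̃|≢2 =
      ∂-length 3 (g ∘ Ψ) w̃ (Cα̃.length-support (Ψ*.pullback (proj₁ z +[ c ] γ))) (|w̃|≢2 ∘ ℕₚ.suc-injective)
    ... | yes |w̃|≡2 =
      trans (Ψ*.∂-transfer g (λ u gu≢0 → proj₁ (Cα.chain-support (proj₁ z +[ c ] γ) u gu≢0)) w̃
                           (subst (2 ≤_) (sym |w̃|≡2) ℕₚ.≤-refl) w̃≢MM (λ ()))
            (trans (∂g (Ψ w̃))
                   (trans (cong₂ (λ x y → c * (x - y)) (𝟙-≢ AB (Ψ w̃) (Ψ-avoids w̃ AB Φ-AB w̃≢MM ∘ sym))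
                                                      (𝟙-≢ BA (Ψ w̃) (Ψ-avoids w̃ BA Φ-BA w̃≢MM ∘ sym)))
                          (ℤₚ.*-zeroʳ c)))
    is-cycle : ∀ w̃ → ∂ (g ∘ Ψ) w̃ ≡ 0ℤ
    is-cycle w̃ with Listₚ.≡-dec ℕ._≟_ w̃ MM
    ... | no  w̃≢MM = ∂g∘Ψ-vanishes w̃ w̃≢MM
    ... | yes refl with Kα̃.vertex-index MM MM-realisable refl
    ...   | i , i< , vi≡MM =
      trans (cong (∂ (g ∘ Ψ)) (sym vi≡MM))
            (trans (sym (Σ<-single (Kα̃.n ∸ 1) i i< (λ k _ k≢i → ∂g∘Ψ-vanishes (Kα̃.vertex k)
                                                                  (λ vk≡MM → k≢i (Kα̃.vertex-injective (trans vk≡MM (sym vi≡MM)))))))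
                   (trans (sym (∂-[ Kα̃.n ] (∂ (g ∘ Ψ)))) (∂∂ (g ∘ Ψ) (Kα̃.n ∷ []))))

  private
    shift-both : ∀ a b k g → a - b ≡ (a + k * g) - (b + k * g)
    shift-both = solve-∀

  to-cong : ∀ x y → Homologous (toList α̃) 3 x y → Homologous (toList α) 3 (to-cycle x) (to-cycle y) × coeff x ≡ coeff y
  to-cong x y (β , ∂β≡x-y) = (Φ*.pullback β , ∂β∘Φ≡) , coeff≡
    where
    pb : ∀ w → ∂ (proj₁ β ∘ Φ) w ≡ pulled x w - pulled y w
    pb = Φ*.pullback-boundary 3 ℕₚ.≤-refl β (λ v → proj₁ (proj₁ x) v - proj₁ (proj₁ y) v)
           (Cα̃.difference-support (proj₁ x) (proj₁ y)) ∂β≡x-y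
    coeff≡ : coeff x ≡ coeff y
    coeff≡ = ℤₚ.i-j≡0⇒i≡j (coeff x) (coeff y)
               (trans (sym (∂-- (pulled x) (pulled y) AB))
                      (trans (∂-cong (λ v → pulled x v - pulled y v) (∂ (proj₁ β ∘ Φ)) AB (sym ∘ pb))
                             (∂∂ (proj₁ β ∘ Φ) AB)))
    ∂β∘Φ≡ : ∀ w → ∂ (proj₁ β ∘ Φ) w ≡ (pulled x w + (- coeff x) * γf w) - (pulled y w + (- coeff y) * γf w)
    ∂β∘Φ≡ w = trans (pb w) (trans (shift-both (pulled x w) (pulled y w) (- coeff x) (γf w))
                                  (cong (λ c → (pulled x w + (- coeff x) * γf w) - (pulled y w + (- c) * γf w)) coeff≡))

  from-cong : ∀ z₁ z₂ c → Homologous (toList α) 3 z₁ z₂ → Homologous (toList α̃) 3 (from-cycle z₁ c) (from-cycle z₂ c)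
  from-cong z₁ z₂ c (β , ∂β≡) = Ψ*.pullback β , λ w →
    trans (Ψ*.pullback-boundary 3 ℕₚ.≤-refl β (λ v → proj₁ (proj₁ z₁) v - proj₁ (proj₁ z₂) v)
             (Cα.difference-support (proj₁ z₁) (proj₁ z₂)) ∂β≡ w)
          (shift-both (proj₁ (proj₁ z₁) (Ψ w)) (proj₁ (proj₁ z₂) (Ψ w)) c (γf (Ψ w)))

  coeff-+ : ∀ x y → coeff (addCycle (toList α̃) 3 x y) ≡ coeff x + coeff y
  coeff-+ x y = ∂-+ (pulled x) (pulled y) AB

  to-hom : ∀ x y → Homologous (toList α) 3 (to-cycle (addCycle _ 3 x y)) (addCycle _ 3 (to-cycle x) (to-cycle y))
  to-hom x y = homologous-≗ (to-cycle (addCycle _ 3 x y)) (addCycle _ 3 (to-cycle x) (to-cycle y)) λ u →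
    trans (cong (λ c → (pulled x u + pulled y u) + (- c) * γf u) (coeff-+ x y))
          (regroup (pulled x u) (pulled y u) (coeff x) (coeff y) (γf u))
    where
    regroup : ∀ a b c d g → (a + b) + (- (c + d)) * g ≡ (a + (- c) * g) + (b + (- d) * g)
    regroup = solve-∀

  coeff-from : ∀ z c → coeff (from-cycle z c) ≡ c
  coeff-from z c =
    trans (∂-cong (pulled (from-cycle z c)) g AB (Φ*.pullback-pullback 3 ℕₚ.≤-refl (proj₁ z +[ c ] γ)))
          (trans (linear (proj₁ (proj₁ z)) c γf AB)
                 (trans (cong₂ (λ x y → x + c * y) (proj₂ z AB) (∂γ AB))
                        (trans (cong₂ (λ x y → 0ℤ + c * (x - y)) (𝟙-refl AB) (𝟙-≢ BA AB (AB≢BA ∘ sym))) (unit c))))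
    where
    g : List ℕ → ℤ
    g u = proj₁ (proj₁ z) u + c * γf u
    unit : ∀ c → 0ℤ + c * (1ℤ - 0ℤ) ≡ c
    unit = solve-∀

  to-from : ∀ z c → Homologous (toList α) 3 (to-cycle (from-cycle z c)) z
  to-from z c = homologous-≗ (to-cycle (from-cycle z c)) z λ u →
    trans (cong₂ (λ x k → x + (- k) * γf u) (Φ*.pullback-pullback 3 ℕₚ.≤-refl (proj₁ z +[ c ] γ) u) (coeff-from z c))
          (cancel (proj₁ (proj₁ z) u) c (γf u))
    where
    cancel : ∀ a c g → (a + c * g) + (- c) * g ≡ a
    cancel = solve-∀

  from-to : ∀ z → Homologous (toList α̃) 3 (from-cycle (to-cycle z) (coeff z)) z
  from-to z = homologous-≗ (from-cycle (to-cycle z) (coeff z)) z λ u →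
    trans (cancel (pulled z (Ψ u)) (coeff z) (γf (Ψ u))) (Ψ*.pullback-pullback 3 ℕₚ.≤-refl (proj₁ z) u)
    where
    cancel : ∀ a c g → (a + (- c) * g) + c * g ≡ a
    cancel = solve-∀

  ≅-3 : H̃ (toList α̃) 3 ≅ (H̃ (toList α) 3 ⊕ ℤ-grp)
  ≅-3 = record
    { to        = λ z → to-cycle z , coeff z
    ; from      = λ (z , c) → from-cycle z c
    ; to-cong   = λ {x} {y} → to-cong x y
    ; from-cong = λ { {z₁ , c} {z₂ , .c} (z₁~z₂ , refl) → from-cong z₁ z₂ c z₁~z₂ }
    ; to-hom    = λ x y → to-hom x y , coeff-+ x y
    ; to-from   = λ (z , c) → to-from z c , coeff-from z c
    ; from-to   = from-to
    }

proposition3p5 :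
    (t : ℕ) → 3 ≤ t →
    (α α̃ : Vec ℕ t) → AllPos α → AllPos α̃ →
    (k : ℕ) → 1 ≤ k → k < t →
    ¬ IsResonance α (front t k) (back t k) →
    ((I J : Subset t) →
      IsResonance α̃ I J ⇔ (IsResonance α I J ⊎ SamePair I J (front t k) (back t k))) →
    (l : ℕ) → H̃ (toList α̃) l ≅ (H̃ (toList α) l ⊕ Extra l)
proposition3p5 (suc (suc (suc t))) _ (a₀ ∷ a₁ ∷ a₂ ∷ a″) (b₀ ∷ b₁ ∷ b₂ ∷ b″) α⁺ α̃⁺ k _ _ ¬resonant resonances = iso
  where
  -- only the complementarity of front t k and back t k is used, not the bounds on k
  open AddedResonance a₀ a₁ a₂ a″ b₀ b₁ b₂ b″ α⁺ α̃⁺ (front _ k) ¬resonant resonances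
  iso : ∀ l → H̃ (toList α̃) l ≅ (H̃ (toList α) l ⊕ Extra l)
  iso 0 = ≅-trivial 0 Kα.vanishing₀ Kα̃.vanishing₀
  iso 1 = ≅-trivial 1 Kα.vanishing₁ Kα̃.vanishing₁
  iso 2 = ≅-trivial 2 Kα.vanishing₂ Kα̃.vanishing₂
  iso 3 = ≅-3
  iso (suc (suc (suc (suc l)))) = ≅-high _ (s≤s (s≤s (s≤s (s≤s z≤n))))
proposition3p5 zero                ()
proposition3p5 (suc zero)          (s≤s ())
proposition3p5 (suc (suc zero))    (s≤s (s≤s ()))
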